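{- Let $q=p^e$, $k\ge 3$, and let $f_i,g_i\in\mathbb{F}_q[X]$ ($3\le i\le k$) have degree at most $q-1$ with $g_i(-X)=-g_i(X)$; let $S(k,q)=S(k,q;f_3,g_3,\ldots,f_k,g_k)$ and $d_g=\max_{3\le i\le k}\deg g_i$, and suppose $1\le d_g<p$. If at least one of the following holds, then $S(k,q)$ is connected: (1) the polynomials $1,X,f_3,\ldots,f_k$ are $\mathbb{F}_q$-linearly independent, and each $g_i$, $3\le i\le k$, has a nonzero coefficient of $X$; (2) the polynomials $f_3,\ldots,f_k$ are $\mathbb{F}_q$-linearly independent, and there exists $j$ with $2\le j\le d_g$ such that each $g_i$, $3\le i\le k$, contains a term $c_{i,j}X^j$ with $c_{i,j}\ne0$.
   Context: The graph $S(k,q;f_3,g_3,\ldots,f_k,g_k)$ has vertex set $\mathbb{F}_q^k$, and $a=(a_1,\ldots,a_k)$ is adjacent to $b=(b_1,\ldots,b_k)$ iff $a_1\ne b_1$ and $b_i-a_i=g_i(b_1-a_1)\,f_i\!\left(\frac{b_2-a_2}{b_1-a_1}\right)$ for all $3\le i\le k$. -}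

module Defs where

open import Data.Nat as ℕ using (ℕ; zero; suc)
open import Data.Fin as Fin using (Fin; toℕ)
open import Data.Fin.Base using (_↑ʳ_)
open import Data.List using (List; length)
open import Data.List.Membership.Propositional using (_∈_)
open import Data.List.Relation.Unary.Unique.Propositional using (Unique)
open import Data.Product using (_×_; Σ; _,_)
import Relation.Nullary
open import Relation.Binary.PropositionalEquality using (_≡_; _≢_)
open import Relation.Binary.Definitions using (DecidableEquality)
open import Relation.Binary.Construct.Closure.ReflexiveTransitive using (Star)
open import Relation.Binary.Construct.Closure.Symmetric using (SymClosure)
open import Algebra.Structures using (IsCommutativeRing)

record FiniteField : Set₁ where
  infixl 6 _+_ _-_
  infixl 7 _*_
  field
    F       : Set
    _+_ _*_ : F → F → F
    -_      : F → F
    0# 1#   : F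
    isCommutativeRing : IsCommutativeRing _≡_ _+_ _*_ -_ 0# 1#
    0≢1     : 0# ≢ 1#
    inv     : F → F
    inv-r   : ∀ x → x ≢ 0# → x * inv x ≡ 1#
    _≟_     : DecidableEquality F
    elems   : List F
    complete : ∀ x → x ∈ elems
    unique  : Unique elems

  card : ℕ
  card = length elems

  _-_ : F → F → F
  x - y = x + (- y)

  _/_ : F → F → F
  x / y = x * inv y

  _^F_ : F → ℕ → F
  x ^F zero  = 1#
  x ^F suc n = x * (x ^F n)

  sumFin : (n : ℕ) → (Fin n → F) → F
  sumFin zero    h = 0#
  sumFin (suc n) h = h Fin.zero + sumFin n (λ j → h (Fin.suc j))

  -- Polynomials of degree at most q-1, given by their coefficient
  -- vectors: c j is the coefficient of X^(toℕ j).
  Poly : Set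
  Poly = Fin card → F

  coeff : Poly → ℕ → F
  coeff c n with n ℕ.<? card
  ... | Relation.Nullary.yes n<q = c (Fin.fromℕ< n<q)
  ... | Relation.Nullary.no _    = 0#

  eval : Poly → F → F
  eval c x = sumFin card (λ j → c j * (x ^F toℕ j))

  -- g(-X) = -g(X) as polynomials (coefficientwise)
  Odd : Poly → Set
  Odd c = ∀ j → c j * ((- 1#) ^F toℕ j) ≡ - (c j)

  DegLe : Poly → ℕ → Set
  DegLe c d = ∀ j → d ℕ.< toℕ j → c j ≡ 0#

  IsMaxDeg : {m : ℕ} → (Fin m → Poly) → ℕ → Set
  IsMaxDeg {m} g d = (∀ i → DegLe (g i) d) × Σ (Fin m) (λ i → coeff (g i) d ≢ 0#)

  monoP : ℕ → Poly
  monoP n j with toℕ j ℕ.≟ n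
  ... | Relation.Nullary.yes _ = 1#
  ... | Relation.Nullary.no _  = 0#

  LinIndep1Xf : {m : ℕ} → (Fin m → Poly) → Set
  LinIndep1Xf {m} f =
    ∀ (a₀ a₁ : F) (b : Fin m → F) →
    (∀ j → a₀ * monoP 0 j + a₁ * monoP 1 j + sumFin m (λ i → b i * f i j) ≡ 0#) →
    (a₀ ≡ 0#) × (a₁ ≡ 0#) × (∀ i → b i ≡ 0#)

  LinIndep : {m : ℕ} → (Fin m → Poly) → Set
  LinIndep {m} f =
    ∀ (b : Fin m → F) →
    (∀ j → sumFin m (λ i → b i * f i j) ≡ 0#) →
    ∀ i → b i ≡ 0#

  -- The graph S(k,q; f_3,g_3,...,f_k,g_k) with k = 2 + n.
  -- Vertices: F^k, coordinates indexed by Fin (2 + n): index 0 is a_1,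
  -- index 1 is a_2, index (2 ↑ʳ i) is a_(i+3).  f i, g i are f_(i+3), g_(i+3).
  Vertex : ℕ → Set
  Vertex n = Fin (2 ℕ.+ n) → F

  Adj : {n : ℕ} → (f g : Fin n → Poly) → Vertex n → Vertex n → Set
  Adj {n} f g a b =
    (a Fin.zero ≢ b Fin.zero) ×
    (∀ i → b ((2 ↑ʳ i)) - a ((2 ↑ʳ i))
             ≡ eval (g i) (b Fin.zero - a Fin.zero)
               * eval (f i) ((b (Fin.suc Fin.zero) - a (Fin.suc Fin.zero))
                             / (b Fin.zero - a Fin.zero)))

  Connected : {n : ℕ} → (f g : Fin n → Poly) → Set
  Connected {n} f g = ∀ (a b : Vertex n) → Star (SymClosure (Adj f g)) a b

-- S(k,q) is the Cayley graph of (F_q^k, +) whose connection set consists of the vectors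
-- e(u,t) = (t, t u, g_i(t) f_i(u)) with t ≠ 0, so it is connected iff they generate F_q^k.
-- In odd characteristic the g_i are odd, so e(u,0) = 0 and the subgroup H they generate
-- contains e(u, m x) for every m ∈ ℕ.  This is a polynomial in m whose coefficients vanish
-- beyond degree d < p, so finite differences (where only divisions by 1, ..., p - 1 occur)
-- put each coefficient x^k C(u,k) in H.  For k = 1 these are the multiples of
-- (1, u, c_{i,1} f_i(u)); a linear form vanishing on all of them would give a relation among
-- 1, X and the f_i, so under (1) they span F_q^k.  Under (2), the coefficient of m^(j-1) in
-- (x + m)^j C(u,j) gives all multiples of (0, 0, c_{i,j} f_i(u)), which span the last k - 2
-- coordinates since the f_i are independent, and k = 1 supplies the first two.
-- In characteristic 2 we have d = 1, only (1) can hold, and for ω ∉ {0, -1} the combination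
-- e(u,x) - e(u,1) - e(u,ω) + e(u,1+ω) equals x C(u,1).

module Submission where

open import Defs
open import Algebra.Bundles using (CommutativeRing; RawRing)
import Algebra.Properties.Ring as RingProperties
import Algebra.Properties.Semiring.Mult as SemiringMult
open import Algebra.Solver.Ring.AlmostCommutativeRing using (AlmostCommutativeRing; fromCommutativeRing; _-Raw-AlmostCommutative⟶_)
import Algebra.Solver.Ring
open import Data.Maybe using (Maybe; just; nothing)
open import Data.Nat as ℕ using (ℕ; zero; suc; _≤_; _<_; _^_; z≤n; s≤s)
import Data.Nat.Properties as ℕ
open import Data.Integer as ℤ using (ℤ; -[1+_])
import Data.Integer.Properties as ℤ
open import Data.Sign as Sign using (Sign)
open import Data.List using (List; []; _∷_; length; map; foldr)
open import Data.List.Membership.Propositional using (_∈_; find; lose)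
open import Data.List.Membership.Propositional.Properties using (∈-map⁺)
open import Data.List.Membership.Propositional.Properties.WithK using (unique∧set⇒bag)
open import Data.List.Relation.Binary.BagAndSetEquality using (∼bag⇒↭)
open import Data.List.Relation.Binary.Permutation.Propositional using (_↭_; ↭⇒↭ₛ)
import Data.List.Relation.Binary.Permutation.Setoid.Properties as PermutationProperties
open import Data.List.Relation.Unary.Any using (here; there; any?)
open import Data.List.Relation.Unary.Unique.Propositional using (Unique)
open import Data.List.Relation.Unary.Unique.Propositional.Properties using (map⁺)
open import Data.List.Relation.Unary.AllPairs using (_∷_)
import Data.List.Relation.Unary.All as All
open import Data.Nat.Primality using (Prime; prime⇒nonTrivial)
open import Data.Nat.Coprimality using (coprime-Bézout; prime⇒coprime)
import Data.Nat.GCD as GCD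
open import Data.Product using (Σ; _×_; _,_; proj₁; proj₂)
open import Data.Sum as Sum using (_⊎_; inj₁; inj₂)
import Data.Vec.Functional as Vec
open import Data.Fin as Fin using (Fin; toℕ; _↑ʳ_) renaming (zero to fzero; suc to fsuc)
import Data.Fin.Properties as Fin
open import Function.Bundles using (mk⇔)
open import Function.Base using (case_of_; _∘_)
open import Relation.Binary.Construct.Closure.ReflexiveTransitive as Star using (Star; ε; _◅_; _◅◅_)
open import Relation.Binary.Construct.Closure.Symmetric as SymClosure using (SymClosure; fwd; bwd)
open import Relation.Binary.PropositionalEquality hiding (resp)
open import Relation.Nullary using (Dec; yes; no; ¬_; ¬?; contradiction)
open import Relation.Nullary.Decidable using (decidable-stable)

module FieldArithmetic (K : FiniteField) where
  open FiniteField K public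

  commutativeRing : CommutativeRing _ _
  commutativeRing = record { isCommutativeRing = isCommutativeRing }

  open CommutativeRing commutativeRing public
    using (+-assoc; +-comm; *-assoc; *-comm; +-identityˡ; +-identityʳ; *-identityˡ; *-identityʳ;
           -‿inverseʳ; +-isCommutativeMonoid; distribˡ; distribʳ; zeroˡ; zeroʳ; ring; semiring)
  open RingProperties ring public using (-‿distribˡ-*; -‿involutive; -0#≈0#; -‿+-comm)
  open SemiringMult semiring using (×-homo-+; ×1-homo-*) renaming (_×_ to _·_)

  fromℕ : ℕ → F
  fromℕ n = n · 1#

  fromℕ-+ : ∀ m n → fromℕ (m ℕ.+ n) ≡ fromℕ m + fromℕ n
  fromℕ-+ = ×-homo-+ 1#

  fromℕ-* : ∀ m n → fromℕ (m ℕ.* n) ≡ fromℕ m * fromℕ n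
  fromℕ-* = ×1-homo-*

  fromSign : Sign → F
  fromSign Sign.+ = 1#
  fromSign Sign.- = - 1#

  fromℤ : ℤ → F
  fromℤ (ℤ.+ n)  = fromℕ n
  fromℤ -[1+ n ] = - fromℕ (suc n)

  private
    -1*x : ∀ x → - x ≡ - 1# * x
    -1*x x = trans (cong -_ (sym (*-identityˡ x))) (-‿distribˡ-* 1# x)

    x-[1+y]≡-1+[x-y] : ∀ x y → x + (- (1# + y)) ≡ - 1# + (x + (- y))
    x-[1+y]≡-1+[x-y] x y = begin
      x + (- (1# + y))     ≡⟨ cong (x +_) (sym (-‿+-comm 1# y)) ⟩
      x + (- 1# + (- y))   ≡⟨ sym (+-assoc x (- 1#) (- y)) ⟩
      (x + - 1#) + (- y)   ≡⟨ cong (_+ (- y)) (+-comm x (- 1#)) ⟩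
      (- 1# + x) + (- y)   ≡⟨ +-assoc (- 1#) x (- y) ⟩
      - 1# + (x + (- y))   ∎
      where open ≡-Reasoning

  fromℤ-◃ : ∀ s n → fromℤ (s ℤ.◃ n) ≡ fromSign s * fromℕ n
  fromℤ-◃ s      zero    = sym (zeroʳ _)
  fromℤ-◃ Sign.+ (suc n) = sym (*-identityˡ _)
  fromℤ-◃ Sign.- (suc n) = -1*x _

  fromSign-* : ∀ s t → fromSign (s Sign.* t) ≡ fromSign s * fromSign t
  fromSign-* Sign.+ t      = sym (*-identityˡ _)
  fromSign-* Sign.- Sign.+ = sym (*-identityʳ _)
  fromSign-* Sign.- Sign.- = sym (trans (sym (-1*x (- 1#))) (-‿involutive 1#))

  fromℤ-sign-abs : ∀ i → fromℤ i ≡ fromSign (ℤ.sign i) * fromℕ ℤ.∣ i ∣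
  fromℤ-sign-abs i = trans (cong fromℤ (sym (ℤ.◃-inverse i))) (fromℤ-◃ (ℤ.sign i) ℤ.∣ i ∣)

  fromℤ-* : ∀ i j → fromℤ (i ℤ.* j) ≡ fromℤ i * fromℤ j
  fromℤ-* i j = begin
    fromℤ (ℤ.sign i Sign.* ℤ.sign j ℤ.◃ ℤ.∣ i ∣ ℕ.* ℤ.∣ j ∣)
      ≡⟨ fromℤ-◃ (ℤ.sign i Sign.* ℤ.sign j) (ℤ.∣ i ∣ ℕ.* ℤ.∣ j ∣) ⟩
    fromSign (ℤ.sign i Sign.* ℤ.sign j) * fromℕ (ℤ.∣ i ∣ ℕ.* ℤ.∣ j ∣)
      ≡⟨ cong₂ _*_ (fromSign-* (ℤ.sign i) (ℤ.sign j)) (fromℕ-* ℤ.∣ i ∣ ℤ.∣ j ∣) ⟩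
    (si * sj) * (ai * aj)
      ≡⟨ *-assoc si sj (ai * aj) ⟩
    si * (sj * (ai * aj))
      ≡⟨ cong (si *_) (trans (sym (*-assoc sj ai aj)) (trans (cong (_* aj) (*-comm sj ai)) (*-assoc ai sj aj))) ⟩
    si * (ai * (sj * aj))
      ≡⟨ sym (*-assoc si ai (sj * aj)) ⟩
    (si * ai) * (sj * aj)
      ≡⟨ sym (cong₂ _*_ (fromℤ-sign-abs i) (fromℤ-sign-abs j)) ⟩
    fromℤ i * fromℤ j ∎
    where
    open ≡-Reasoning
    si = fromSign (ℤ.sign i)
    sj = fromSign (ℤ.sign j)
    ai = fromℕ ℤ.∣ i ∣
    aj = fromℕ ℤ.∣ j ∣

  fromℤ-⊖ : ∀ m n → fromℤ (m ℤ.⊖ n) ≡ fromℕ m - fromℕ n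
  fromℤ-⊖ zero    zero    = sym (trans (cong (0# +_) -0#≈0#) (+-identityˡ 0#))
  fromℤ-⊖ (suc m) zero    = sym (trans (cong (fromℕ (suc m) +_) -0#≈0#) (+-identityʳ _))
  fromℤ-⊖ zero    (suc n) = sym (+-identityˡ _)
  fromℤ-⊖ (suc m) (suc n) = begin
    fromℤ (suc m ℤ.⊖ suc n)            ≡⟨ cong fromℤ (ℤ.[1+m]⊖[1+n]≡m⊖n m n) ⟩
    fromℤ (m ℤ.⊖ n)                    ≡⟨ fromℤ-⊖ m n ⟩
    fromℕ m - fromℕ n                  ≡⟨ sym (+-identityˡ _) ⟩
    0# + (fromℕ m - fromℕ n)           ≡⟨ cong (_+ (fromℕ m - fromℕ n)) (sym (-‿inverseʳ 1#)) ⟩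
    (1# - 1#) + (fromℕ m - fromℕ n)    ≡⟨ +-assoc 1# (- 1#) _ ⟩
    1# + (- 1# + (fromℕ m - fromℕ n))  ≡⟨ cong (1# +_) (sym (x-[1+y]≡-1+[x-y] (fromℕ m) (fromℕ n))) ⟩
    1# + (fromℕ m - fromℕ (suc n))     ≡⟨ sym (+-assoc 1# (fromℕ m) _) ⟩
    fromℕ (suc m) - fromℕ (suc n)      ∎
    where open ≡-Reasoning

  fromℤ-+ : ∀ i j → fromℤ (i ℤ.+ j) ≡ fromℤ i + fromℤ j
  fromℤ-+ (ℤ.+ m)  (ℤ.+ n)  = fromℕ-+ m n
  fromℤ-+ (ℤ.+ m)  -[1+ n ] = fromℤ-⊖ m (suc n)
  fromℤ-+ -[1+ m ] (ℤ.+ n)  = trans (fromℤ-⊖ n (suc m)) (+-comm _ _)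
  fromℤ-+ -[1+ m ] -[1+ n ] =
    trans (cong (λ k → - fromℕ (suc k)) (sym (ℕ.+-suc m n)))
          (trans (cong -_ (fromℕ-+ (suc m) (suc n))) (sym (-‿+-comm _ _)))

  fromℤ-neg : ∀ i → fromℤ (ℤ.- i) ≡ - fromℤ i
  fromℤ-neg -[1+ n ]          = sym (-‿involutive _)
  fromℤ-neg (ℤ.+ zero)        = sym -0#≈0#
  fromℤ-neg (ℤ.+ suc n)       = refl

  -- The coefficient map of the ring solver; it sends ±1 to 1# and - 1# on the nose,
  -- so that the solver's constants ±1 need no conversion.
  ⟦_⟧ : ℤ → F
  ⟦ ℤ.+ 1   ⟧ = 1#
  ⟦ -[1+ 0 ] ⟧ = - 1#
  ⟦ i        ⟧ = fromℤ i

  ⟦⟧≡fromℤ : ∀ i → ⟦ i ⟧ ≡ fromℤ i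
  ⟦⟧≡fromℤ (ℤ.+ 0)           = refl
  ⟦⟧≡fromℤ (ℤ.+ 1)           = sym (+-identityʳ 1#)
  ⟦⟧≡fromℤ (ℤ.+ suc (suc n)) = refl
  ⟦⟧≡fromℤ -[1+ 0 ]          = cong -_ (sym (+-identityʳ 1#))
  ⟦⟧≡fromℤ -[1+ suc n ]      = refl

  private
    ℤ-rawRing : RawRing _ _
    ℤ-rawRing = record
      { Carrier = ℤ ; _≈_ = _≡_ ; _+_ = ℤ._+_ ; _*_ = ℤ._*_ ; -_ = ℤ.-_ ; 0# = ℤ.+ 0 ; 1# = ℤ.+ 1 }

    almostCommutativeRing : AlmostCommutativeRing _ _
    almostCommutativeRing = fromCommutativeRing commutativeRing

    homomorphism : ℤ-rawRing -Raw-AlmostCommutative⟶ almostCommutativeRing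
    homomorphism = record
      { ⟦_⟧    = ⟦_⟧
      ; +-homo = λ i j → via⟦⟧ (i ℤ.+ j) (fromℤ-+ i j) (cong₂ _+_ (⟦⟧≡fromℤ i) (⟦⟧≡fromℤ j))
      ; *-homo = λ i j → via⟦⟧ (i ℤ.* j) (fromℤ-* i j) (cong₂ _*_ (⟦⟧≡fromℤ i) (⟦⟧≡fromℤ j))
      ; -‿homo = λ i → via⟦⟧ (ℤ.- i) (fromℤ-neg i) (cong -_ (⟦⟧≡fromℤ i))
      ; 0-homo = refl
      ; 1-homo = refl
      }
      where
      via⟦⟧ : ∀ i {y z} → fromℤ i ≡ y → z ≡ y → ⟦ i ⟧ ≡ z
      via⟦⟧ i e e′ = trans (⟦⟧≡fromℤ i) (trans e (sym e′))

    ℤ-equal? : ∀ i j → Maybe (⟦ i ⟧ ≡ ⟦ j ⟧)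
    ℤ-equal? i j with i ℤ.≟ j
    ... | yes refl = just refl
    ... | no _     = nothing

  open Algebra.Solver.Ring ℤ-rawRing almostCommutativeRing homomorphism ℤ-equal? public
    using (solve; _:=_; _:+_; _:*_; :-_; _:-_; con; Polynomial)

  :0 :1 : ∀ {n} → Polynomial n
  :0 = con (ℤ.+ 0)
  :1 = con (ℤ.+ 1)

  inv-l : ∀ x → x ≢ 0# → inv x * x ≡ 1#
  inv-l x x≢0 = trans (*-comm (inv x) x) (inv-r x x≢0)

  x*y≡0⇒y≡0 : ∀ {x y} → x ≢ 0# → x * y ≡ 0# → y ≡ 0#
  x*y≡0⇒y≡0 {x} {y} x≢0 xy≡0 = begin
    y                ≡⟨ solve 2 (λ y i → y := y :* :1) refl y (inv x) ⟩
    y * 1#           ≡⟨ cong (y *_) (sym (inv-l x x≢0)) ⟩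
    y * (inv x * x)  ≡⟨ solve 3 (λ x y i → y :* (i :* x) := i :* (x :* y)) refl x y (inv x) ⟩
    inv x * (x * y)  ≡⟨ cong (inv x *_) xy≡0 ⟩
    inv x * 0#       ≡⟨ zeroʳ (inv x) ⟩
    0#               ∎
    where open ≡-Reasoning

  x^k≡0⇒x≡0 : ∀ x k → x ^F k ≡ 0# → x ≡ 0#
  x^k≡0⇒x≡0 x zero    1≡0 = contradiction (sym 1≡0) 0≢1
  x^k≡0⇒x≡0 x (suc k) e with x ≟ 0#
  ... | yes x≡0 = x≡0
  ... | no x≢0  = x^k≡0⇒x≡0 x k (x*y≡0⇒y≡0 x≢0 e)

  ^F-distrib-* : ∀ x y k → (x * y) ^F k ≡ x ^F k * y ^F k
  ^F-distrib-* x y zero    = sym (*-identityˡ 1#)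
  ^F-distrib-* x y (suc k) = trans (cong ((x * y) *_) (^F-distrib-* x y k))
    (solve 4 (λ x y a b → (x :* y) :* (a :* b) := (x :* a) :* (y :* b)) refl x y (x ^F k) (y ^F k))

  fromℕ-^ : ∀ m k → fromℕ m ^F k ≡ fromℕ (m ℕ.^ k)
  fromℕ-^ m zero    = sym (+-identityʳ 1#)
  fromℕ-^ m (suc k) = trans (cong (fromℕ m *_) (fromℕ-^ m k)) (sym (fromℕ-* m (m ℕ.^ k)))

module Characteristic (K : FiniteField) where
  open FieldArithmetic K

  2≤card : 2 ≤ card
  2≤card = go elems complete
    where
    go : (xs : List F) → (∀ x → x ∈ xs) → 2 ≤ length xs
    go []          ∈xs = case ∈xs 0# of λ ()
    go (_ ∷ [])    ∈xs with ∈xs 0# | ∈xs 1#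
    ... | here refl | here refl = contradiction refl 0≢1
    go (_ ∷ _ ∷ _) ∈xs = s≤s (s≤s z≤n)

  private
    ∑ : List F → F
    ∑ = foldr _+_ 0#

    ∑-map-+1 : ∀ xs → ∑ (map (_+ 1#) xs) ≡ ∑ xs + fromℕ (length xs)
    ∑-map-+1 []       = sym (+-identityˡ 0#)
    ∑-map-+1 (x ∷ xs) = trans (cong ((x + 1#) +_) (∑-map-+1 xs))
      (solve 3 (λ x s n → (x :+ :1) :+ (s :+ n) := (x :+ s) :+ (:1 :+ n)) refl x (∑ xs) (fromℕ (length xs)))

    +1-permutes : map (_+ 1#) elems ↭ elems
    +1-permutes = ∼bag⇒↭ (unique∧set⇒bag (map⁺ +1-injective unique) unique
      (λ {x} → mk⇔ (λ _ → complete x) (λ _ → subst (_∈ map (_+ 1#) elems) (x-1+1≡x x) (∈-map⁺ (_+ 1#) (complete (x - 1#))))))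
      where
      x-1+1≡x : ∀ x → (x - 1#) + 1# ≡ x
      x-1+1≡x x = solve 1 (λ x → (x :- :1) :+ :1 := x) refl x
      +1-injective : ∀ {x y} → x + 1# ≡ y + 1# → x ≡ y
      +1-injective {x} {y} e = trans (sym (x+1-1≡x x)) (trans (cong (_- 1#) e) (x+1-1≡x y))
        where
        x+1-1≡x : ∀ x → (x + 1#) - 1# ≡ x
        x+1-1≡x x = solve 1 (λ x → (x :+ :1) :- :1 := x) refl x

  -- Translation by 1 permutes the elements, so it leaves their sum unchanged.
  fromℕ-card≡0 : fromℕ card ≡ 0#
  fromℕ-card≡0 = begin
    fromℕ card                         ≡⟨ solve 2 (λ n s → n := (s :+ n) :- s) refl (fromℕ card) (∑ elems) ⟩
    (∑ elems + fromℕ card) - ∑ elems   ≡⟨ cong (_- ∑ elems) (sym (∑-map-+1 elems)) ⟩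
    ∑ (map (_+ 1#) elems) - ∑ elems    ≡⟨ cong (_- ∑ elems) (PermutationProperties.foldr-commMonoid (setoid F) +-isCommutativeMonoid (↭⇒↭ₛ +1-permutes)) ⟩
    ∑ elems - ∑ elems                  ≡⟨ -‿inverseʳ (∑ elems) ⟩
    0#                                 ∎
    where open ≡-Reasoning

  module _ {p e : ℕ} (p-prime : Prime p) (card≡p^e : card ≡ p ℕ.^ e) where

    fromℕ-p≡0 : fromℕ p ≡ 0#
    fromℕ-p≡0 = x^k≡0⇒x≡0 (fromℕ p) e (begin
      fromℕ p ^F e      ≡⟨ fromℕ-^ p e ⟩
      fromℕ (p ℕ.^ e)   ≡⟨ cong fromℕ (sym card≡p^e) ⟩
      fromℕ card        ≡⟨ fromℕ-card≡0 ⟩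
      0#                ∎)
      where open ≡-Reasoning

    p≤card : p ≤ card
    p≤card = p≤p^e e card≡p^e
      where
      0<p : 0 < p
      0<p = ℕ.<-trans (s≤s z≤n) (ℕ.nonTrivial⇒n>1 p {{prime⇒nonTrivial p-prime}})
      p≤p^e : ∀ e → card ≡ p ℕ.^ e → p ≤ card
      p≤p^e zero    card≡1     = contradiction card≡1 (ℕ.>⇒≢ 2≤card)
      p≤p^e (suc e) card≡p*p^e =
        subst (p ≤_) (sym card≡p*p^e) (ℕ.m≤m*n p (p ℕ.^ e) {{ℕ.m^n≢0 p e {{ℕ.>-nonZero 0<p}}}})

  module _ {p : ℕ} (p-prime : Prime p) (fromℕ-p≡0 : fromℕ p ≡ 0#) where

    private
      fromℕ-*p≡0 : ∀ x → fromℕ (x ℕ.* p) ≡ 0#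
      fromℕ-*p≡0 x = trans (fromℕ-* x p) (trans (cong (fromℕ x *_) fromℕ-p≡0) (zeroʳ _))

    fromℕ-unit : ∀ {a} → 0 < a → a < p → Σ ℤ λ b → fromℤ b * fromℕ a ≡ 1#
    fromℕ-unit {suc a} _ a<p with coprime-Bézout (prime⇒coprime p-prime a<p)
    ... | GCD.Bézout.+- x y eq = ℤ.- ℤ.+ y , (begin
      fromℤ (ℤ.- ℤ.+ y) * fromℕ (suc a)     ≡⟨ cong (_* fromℕ (suc a)) (fromℤ-neg (ℤ.+ y)) ⟩
      - fromℕ y * fromℕ (suc a)             ≡⟨ solve 2 (λ y a → :- y :* a := :1 :- (:1 :+ y :* a)) refl (fromℕ y) (fromℕ (suc a)) ⟩
      1# - (1# + fromℕ y * fromℕ (suc a))   ≡⟨ cong (λ z → 1# - (1# + z)) (sym (fromℕ-* y (suc a))) ⟩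
      1# - fromℕ (1 ℕ.+ y ℕ.* suc a)        ≡⟨ cong (λ n → 1# - fromℕ n) eq ⟩
      1# - fromℕ (x ℕ.* p)                  ≡⟨ cong (λ z → 1# - z) (fromℕ-*p≡0 x) ⟩
      1# - 0#                               ≡⟨ solve 0 (:1 :- :0 := :1) refl ⟩
      1#                                    ∎)
      where open ≡-Reasoning
    ... | GCD.Bézout.-+ x y eq = ℤ.+ y , (begin
      fromℕ y * fromℕ (suc a)      ≡⟨ sym (fromℕ-* y (suc a)) ⟩
      fromℕ (y ℕ.* suc a)          ≡⟨ cong fromℕ (sym eq) ⟩
      fromℕ (1 ℕ.+ x ℕ.* p)        ≡⟨ fromℕ-+ 1 (x ℕ.* p) ⟩
      fromℕ 1 + fromℕ (x ℕ.* p)    ≡⟨ cong (fromℕ 1 +_) (fromℕ-*p≡0 x) ⟩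
      (1# + 0#) + 0#               ≡⟨ solve 0 ((:1 :+ :0) :+ :0 := :1) refl ⟩
      1#                           ∎)
      where open ≡-Reasoning

    fromℕ≢0 : ∀ {a} → 0 < a → a < p → fromℕ a ≢ 0#
    fromℕ≢0 0<a a<p a≡0 with fromℕ-unit 0<a a<p
    ... | b , ba≡1 = 0≢1 (trans (sym (zeroʳ (fromℤ b))) (trans (cong (fromℤ b *_) (sym a≡0)) ba≡1))

module Sums (K : FiniteField) where
  open FieldArithmetic K

  sumFin-cong : ∀ n {a b : Fin n → F} → (∀ j → a j ≡ b j) → sumFin n a ≡ sumFin n b
  sumFin-cong zero    a≡b = refl
  sumFin-cong (suc n) a≡b = cong₂ _+_ (a≡b fzero) (sumFin-cong n (λ j → a≡b (fsuc j)))

  sumFin-+ : ∀ n (a b : Fin n → F) → sumFin n (λ j → a j + b j) ≡ sumFin n a + sumFin n b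
  sumFin-+ zero    a b = solve 0 (:0 := :0 :+ :0) refl
  sumFin-+ (suc n) a b = trans (cong (a fzero + b fzero +_) (sumFin-+ n (λ j → a (fsuc j)) (λ j → b (fsuc j))))
    (solve 4 (λ a b s t → a :+ b :+ (s :+ t) := a :+ s :+ (b :+ t)) refl (a fzero) (b fzero) _ _)

  sumFin-*ˡ : ∀ n x (a : Fin n → F) → sumFin n (λ j → x * a j) ≡ x * sumFin n a
  sumFin-*ˡ zero    x a = sym (zeroʳ x)
  sumFin-*ˡ (suc n) x a = trans (cong (x * a fzero +_) (sumFin-*ˡ n x (λ j → a (fsuc j)))) (sym (distribˡ x _ _))

  sumFin-*ʳ : ∀ n x (a : Fin n → F) → sumFin n (λ j → a j * x) ≡ sumFin n a * x
  sumFin-*ʳ n x a = trans (sumFin-cong n (λ j → *-comm (a j) x)) (trans (sumFin-*ˡ n x a) (*-comm x _))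

  sumFin-zero : ∀ n (a : Fin n → F) → (∀ j → a j ≡ 0#) → sumFin n a ≡ 0#
  sumFin-zero zero    a a≡0 = refl
  sumFin-zero (suc n) a a≡0 = trans (cong₂ _+_ (a≡0 fzero) (sumFin-zero n _ (λ j → a≡0 (fsuc j)))) (+-identityˡ 0#)

  sumFin-swap : ∀ m n (h : Fin n → Fin m → F) →
    sumFin m (λ j → sumFin n (λ i → h i j)) ≡ sumFin n (λ i → sumFin m (h i))
  sumFin-swap m zero    h = sumFin-zero m _ (λ j → refl)
  sumFin-swap m (suc n) h = trans (sumFin-+ m (h fzero) (λ j → sumFin n (λ i → h (fsuc i) j)))
    (cong (sumFin m (h fzero) +_) (sumFin-swap m n (λ i → h (fsuc i))))

  sumTo : ℕ → (ℕ → F) → F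
  sumTo zero    h = 0#
  sumTo (suc n) h = h n + sumTo n h

  sumTo-cong : ∀ n {a b : ℕ → F} → (∀ k → a k ≡ b k) → sumTo n a ≡ sumTo n b
  sumTo-cong zero    a≡b = refl
  sumTo-cong (suc n) a≡b = cong₂ _+_ (a≡b n) (sumTo-cong n a≡b)

  sumTo-+ : ∀ n (a b : ℕ → F) → sumTo n (λ k → a k + b k) ≡ sumTo n a + sumTo n b
  sumTo-+ zero    a b = solve 0 (:0 := :0 :+ :0) refl
  sumTo-+ (suc n) a b = trans (cong (a n + b n +_) (sumTo-+ n a b))
    (solve 4 (λ a b s t → a :+ b :+ (s :+ t) := a :+ s :+ (b :+ t)) refl (a n) (b n) _ _)

  sumTo-*ˡ : ∀ n x (a : ℕ → F) → sumTo n (λ k → x * a k) ≡ x * sumTo n a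
  sumTo-*ˡ zero    x a = sym (zeroʳ x)
  sumTo-*ˡ (suc n) x a = trans (cong (x * a n +_) (sumTo-*ˡ n x a)) (sym (distribˡ x _ _))

  sumTo-*ʳ : ∀ n x (a : ℕ → F) → sumTo n (λ k → a k * x) ≡ sumTo n a * x
  sumTo-*ʳ n x a = trans (sumTo-cong n (λ k → *-comm (a k) x)) (trans (sumTo-*ˡ n x a) (*-comm x _))

  sumTo-suc : ∀ n (h : ℕ → F) → sumTo (suc n) h ≡ h 0 + sumTo n (λ k → h (suc k))
  sumTo-suc zero    h = refl
  sumTo-suc (suc n) h = trans (cong (h (suc n) +_) (sumTo-suc n h))
    (solve 3 (λ a b s → b :+ (a :+ s) := a :+ (b :+ s)) refl (h 0) (h (suc n)) _)

  sumTo-zero : ∀ n (h : ℕ → F) → (∀ k → k < n → h k ≡ 0#) → sumTo n h ≡ 0#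
  sumTo-zero zero    h h≡0 = refl
  sumTo-zero (suc n) h h≡0 =
    trans (cong₂ _+_ (h≡0 n ℕ.≤-refl) (sumTo-zero n h (λ k k<n → h≡0 k (ℕ.m<n⇒m<1+n k<n)))) (+-identityˡ 0#)

  sumTo-single : ∀ n (h : ℕ → F) {k₀} → k₀ < n → (∀ k → k ≢ k₀ → h k ≡ 0#) → sumTo n h ≡ h k₀
  sumTo-single (suc n) h {k₀} k₀<1+n h≡0 with n ℕ.≟ k₀
  ... | yes refl = trans (cong (h n +_) (sumTo-zero n h (λ k k<n → h≡0 k (ℕ.<⇒≢ k<n)))) (+-identityʳ _)
  ... | no n≢k₀  = trans (cong₂ _+_ (h≡0 n n≢k₀) (sumTo-single n h (ℕ.≤∧≢⇒< (ℕ.≤-pred k₀<1+n) (≢-sym n≢k₀)) h≡0))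
                         (+-identityˡ _)

  sumTo-truncate : ∀ {n} m (h : ℕ → F) → n ≤ m → (∀ k → n ≤ k → h k ≡ 0#) → sumTo m h ≡ sumTo n h
  sumTo-truncate zero    h z≤n _   = refl
  sumTo-truncate (suc m) h n≤1+m h≡0 with ℕ.m≤n⇒m<n∨m≡n n≤1+m
  ... | inj₂ refl  = refl
  ... | inj₁ n<1+m = trans (cong₂ _+_ (h≡0 m (ℕ.≤-pred n<1+m)) (sumTo-truncate m h (ℕ.≤-pred n<1+m) h≡0)) (+-identityˡ _)

  sumFin-single : ∀ n (h : Fin n → F) j₀ → (∀ j → j ≢ j₀ → h j ≡ 0#) → sumFin n h ≡ h j₀
  sumFin-single (suc n) h fzero     h≡0 = trans (cong (h fzero +_) (sumFin-zero n _ (λ j → h≡0 (fsuc j) (λ ())))) (+-identityʳ _)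
  sumFin-single (suc n) h (fsuc j₀) h≡0 =
    trans (cong₂ _+_ (h≡0 fzero (λ ())) (sumFin-single n (λ j → h (fsuc j)) j₀ (λ j j≢j₀ → h≡0 (fsuc j) (j≢j₀ ∘ Fin.suc-injective))))
          (+-identityˡ _)

  sumFin-sumTo : ∀ n (h : ℕ → F) → sumFin n (λ j → h (toℕ j)) ≡ sumTo n h
  sumFin-sumTo zero    h = refl
  sumFin-sumTo (suc n) h = trans (cong (h 0 +_) (sumFin-sumTo n (λ k → h (suc k)))) (sym (sumTo-suc n h))

module Vectors (K : FiniteField) where
  open FieldArithmetic K

  Vector : ℕ → Set
  Vector N = Fin N → F

  infixl 6 _⊕_ _⊖_
  infixr 7 _•_

  _⊕_ _⊖_ : ∀ {N} → Vector N → Vector N → Vector N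
  (u ⊕ v) t = u t + v t
  (u ⊖ v) t = u t - v t

  ⊝_ : ∀ {N} → Vector N → Vector N
  (⊝ u) t = - u t

  _•_ : ∀ {N} → F → Vector N → Vector N
  (x • u) t = x * u t

  0V : ∀ {N} → Vector N
  0V t = 0#

  record IsAdditiveSubgroup {N} (H : Vector N → Set) : Set where
    field
      resp : ∀ {u v} → u ≗ v → H u → H v
      0∈   : H 0V
      ⊕∈   : ∀ {u v} → H u → H v → H (u ⊕ v)
      ⊝∈   : ∀ {u} → H u → H (⊝ u)

    ⊖∈ : ∀ {u v} → H u → H v → H (u ⊖ v)
    ⊖∈ u∈ v∈ = ⊕∈ u∈ (⊝∈ v∈)

    fromℕ•∈ : ∀ k {v} → H v → H (fromℕ k • v)
    fromℕ•∈ zero    {v} _  = resp (λ t → sym (zeroˡ (v t))) 0∈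
    fromℕ•∈ (suc k) {v} v∈ = resp (λ t → solve 2 (λ x y → x :+ y :* x := (:1 :+ y) :* x) refl (v t) (fromℕ k))
                                  (⊕∈ v∈ (fromℕ•∈ k v∈))

    fromℤ•∈ : ∀ i {v} → H v → H (fromℤ i • v)
    fromℤ•∈ (ℤ.+ k)  v∈     = fromℕ•∈ k v∈
    fromℤ•∈ -[1+ k ] {v} v∈ = resp (λ t → -‿distribˡ-* (fromℕ (suc k)) (v t)) (⊝∈ (fromℕ•∈ (suc k) v∈))

  0∷-subgroup : ∀ {N} {H : Vector (suc N) → Set} → IsAdditiveSubgroup H → IsAdditiveSubgroup (λ v → H (0# Vec.∷ v))
  0∷-subgroup subgroup = record
    { resp = λ v≗v′ → resp (λ { fzero → refl ; (fsuc t) → v≗v′ t })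
    ; 0∈   = resp (λ { fzero → refl ; (fsuc t) → refl }) 0∈
    ; ⊕∈   = λ u∈ v∈ → resp (λ { fzero → +-identityˡ 0# ; (fsuc t) → refl }) (⊕∈ u∈ v∈)
    ; ⊝∈   = λ v∈ → resp (λ { fzero → -0#≈0# ; (fsuc t) → refl }) (⊝∈ v∈)
    }
    where open IsAdditiveSubgroup subgroup

module FiniteDifferences (K : FiniteField) (N : ℕ) where
  open FieldArithmetic K
  open Sums K
  open Vectors K

  Sequence : Set
  Sequence = ℕ → Vector N

  Δ : Sequence → Sequence
  Δ φ m = φ (suc m) ⊖ φ m

  -- Leading D L φ: the D-th difference of φ is constantly D! • L, that is, φ is a
  -- polynomial sequence of degree at most D whose coefficient of m^D is L.
  Leading : ℕ → Vector N → Sequence → Set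
  Leading zero    L φ = ∀ m → φ m ≗ L
  Leading (suc D) L φ = Leading D (fromℕ (suc D) • L) (Δ φ)

  Leading-cong : ∀ D {L L′ φ ψ} → (∀ m → φ m ≗ ψ m) → L ≗ L′ → Leading D L φ → Leading D L′ ψ
  Leading-cong zero    φ≗ψ L≗L′ lead m t = trans (sym (φ≗ψ m t)) (trans (lead m t) (L≗L′ t))
  Leading-cong (suc D) φ≗ψ L≗L′ lead = Leading-cong D (λ m t → cong₂ _-_ (φ≗ψ (suc m) t) (φ≗ψ m t))
                                                       (λ t → cong (fromℕ (suc D) *_) (L≗L′ t)) lead

  Leading-⊕ : ∀ D {L L′ φ ψ} → Leading D L φ → Leading D L′ ψ → Leading D (L ⊕ L′) (λ m → φ m ⊕ ψ m)
  Leading-⊕ zero    lead lead′ m t = cong₂ _+_ (lead m t) (lead′ m t)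
  Leading-⊕ (suc D) {L} {L′} {φ} {ψ} lead lead′ = Leading-cong D
    (λ m t → solve 4 (λ a b a′ b′ → (a :- a′) :+ (b :- b′) := (a :+ b) :- (a′ :+ b′)) refl
                     (φ (suc m) t) (ψ (suc m) t) (φ m t) (ψ m t))
    (λ t → sym (distribˡ (fromℕ (suc D)) (L t) (L′ t)))
    (Leading-⊕ D lead lead′)

  Leading-shift : ∀ D {L φ} → Leading D L φ → Leading D L (λ m → φ (suc m))
  Leading-shift zero    lead m = lead (suc m)
  Leading-shift (suc D) lead   = Leading-shift D lead

  Leading-suc : ∀ D {L φ} → Leading D L φ → Leading (suc D) 0V φ
  Leading-suc zero {L} {φ} lead m t = begin
    φ (suc m) t - φ m t             ≡⟨ cong₂ _-_ (lead (suc m) t) (lead m t) ⟩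
    L t - L t                       ≡⟨ solve 1 (λ x → x :- x := (:1 :+ :0) :* :0) refl (L t) ⟩
    fromℕ 1 * 0#                    ∎
    where open ≡-Reasoning
  Leading-suc (suc D) lead = Leading-cong (suc D) (λ m t → refl) (λ t → sym (zeroʳ _)) (Leading-suc D lead)

  -- Δ (m • φ m) = (m • Δφ m) ⊕ φ (m + 1)
  Leading-*m : ∀ D {L φ} → Leading D L φ → Leading (suc D) L (λ m → fromℕ m • φ m)
  Leading-*m zero {L} {φ} lead m t = begin
    (1# + fromℕ m) * φ (suc m) t - fromℕ m * φ m t ≡⟨ cong₂ (λ x y → (1# + fromℕ m) * x - fromℕ m * y) (lead (suc m) t) (lead m t) ⟩
    (1# + fromℕ m) * L t - fromℕ m * L t           ≡⟨ solve 2 (λ n x → (:1 :+ n) :* x :- n :* x := (:1 :+ :0) :* x) refl (fromℕ m) (L t) ⟩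
    fromℕ 1 * L t                                  ∎
    where open ≡-Reasoning
  Leading-*m (suc D) {L} {φ} lead = Leading-cong (suc D)
    (λ m t → solve 3 (λ n x y → n :* (x :- y) :+ x := (:1 :+ n) :* x :- n :* y) refl (fromℕ m) (φ (suc m) t) (φ m t))
    (λ t → solve 2 (λ d x → d :* x :+ x := (:1 :+ d) :* x) refl (fromℕ (suc D)) (L t))
    (Leading-⊕ (suc D) (Leading-*m D lead) (Leading-shift (suc D) lead))

  Leading-monomial : ∀ k A → Leading k A (λ m → fromℕ m ^F k • A)
  Leading-monomial zero    A m t = *-identityˡ (A t)
  Leading-monomial (suc k) A = Leading-cong (suc k) (λ m t → sym (*-assoc (fromℕ m) (fromℕ m ^F k) (A t))) (λ t → refl)
                                 (Leading-*m k (Leading-monomial k A))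

  polynomialSequence : ℕ → (ℕ → Vector N) → Sequence
  polynomialSequence n A m t = sumTo n (λ k → fromℕ m ^F k * A k t)

  Leading-polynomialSequence : ∀ n A → Leading n 0V (polynomialSequence n A)
  Leading-polynomialSequence-top : ∀ n A → Leading n (A n) (polynomialSequence (suc n) A)
  Leading-polynomialSequence zero    A m t = refl
  Leading-polynomialSequence (suc n) A = Leading-suc n (Leading-polynomialSequence-top n A)
  Leading-polynomialSequence-top n A =
    Leading-cong n (λ m t → refl) (λ t → +-identityʳ (A n t))
      (Leading-⊕ n (Leading-monomial n (A n)) (Leading-polynomialSequence n A))

module CoefficientsInSubgroup
  (K : FiniteField) {N : ℕ} {H : Vectors.Vector K N → Set} (subgroup : Vectors.IsAdditiveSubgroup K H)
  {p : ℕ} (p-prime : Prime p) (fromℕ-p≡0 : FieldArithmetic.fromℕ K p ≡ FiniteField.0# K)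
  where
  open FieldArithmetic K
  open Characteristic K using (fromℕ-unit)
  open Vectors K
  open IsAdditiveSubgroup subgroup
  open FiniteDifferences K N

  fromℕ•∈⁻¹ : ∀ {a v} → 0 < a → a < p → H (fromℕ a • v) → H v
  fromℕ•∈⁻¹ {a} {v} 0<a a<p av∈ with fromℕ-unit p-prime fromℕ-p≡0 0<a a<p
  ... | b , ba≡1 = resp b[av]≡v (fromℤ•∈ b av∈)
    where
    b[av]≡v : fromℤ b • (fromℕ a • v) ≗ v
    b[av]≡v t = begin
      fromℤ b * (fromℕ a * v t)   ≡⟨ sym (*-assoc _ _ _) ⟩
      (fromℤ b * fromℕ a) * v t   ≡⟨ cong (_* v t) ba≡1 ⟩
      1# * v t                    ≡⟨ *-identityˡ (v t) ⟩
      v t                         ∎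
      where open ≡-Reasoning

  -- D! • L is the D-th difference of φ at 0, a ℤ-combination of φ 0, ..., φ D.
  Leading⇒∈ : ∀ D {L φ} → Leading D L φ → D < p → (∀ m → m ≤ D → H (φ m)) → H L
  Leading⇒∈ zero    lead _   φ∈ = resp (lead 0) (φ∈ 0 z≤n)
  Leading⇒∈ (suc D) lead D<p φ∈ = fromℕ•∈⁻¹ (s≤s z≤n) D<p
    (Leading⇒∈ D lead (ℕ.<-trans (ℕ.n<1+n D) D<p)
      (λ m m≤D → ⊖∈ (φ∈ (suc m) (s≤s m≤D)) (φ∈ m (ℕ.m≤n⇒m≤1+n m≤D))))

  private
    top-coefficient∈ : ∀ n A → (∀ m → H (polynomialSequence (suc n) A m)) → (∀ k → p ≤ k → A k ≗ 0V) → H (A n)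
    top-coefficient∈ n A φ∈ A≗0 with n ℕ.<? p
    ... | yes n<p = Leading⇒∈ n (Leading-polynomialSequence-top n A) n<p (λ m _ → φ∈ m)
    ... | no n≮p  = resp (λ t → sym (A≗0 n (ℕ.≮⇒≥ n≮p) t)) 0∈

    drop-top-term : ∀ n A m → polynomialSequence (suc n) A m ⊖ fromℕ (m ℕ.^ n) • A n ≗ polynomialSequence n A m
    drop-top-term n A m t = begin
      (fromℕ m ^F n * A n t + polynomialSequence n A m t) - fromℕ (m ℕ.^ n) * A n t
        ≡⟨ cong (λ x → (fromℕ m ^F n * A n t + polynomialSequence n A m t) - x * A n t) (sym (fromℕ-^ m n)) ⟩
      (fromℕ m ^F n * A n t + polynomialSequence n A m t) - fromℕ m ^F n * A n t
        ≡⟨ solve 2 (λ a b → (a :+ b) :- a := b) refl (fromℕ m ^F n * A n t) (polynomialSequence n A m t) ⟩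
      polynomialSequence n A m t ∎
      where open ≡-Reasoning

  polynomialSequence-coefficients∈ : ∀ n A → (∀ m → H (polynomialSequence n A m)) →
    (∀ k → p ≤ k → A k ≗ 0V) → ∀ k → k < n → H (A k)
  polynomialSequence-coefficients∈ (suc n) A φ∈ A≗0 k k<1+n with k ℕ.≟ n
  ... | yes refl = top-coefficient∈ n A φ∈ A≗0
  ... | no k≢n   = polynomialSequence-coefficients∈ n A lower∈ A≗0 k (ℕ.≤∧≢⇒< (ℕ.≤-pred k<1+n) k≢n)
    where
    lower∈ : ∀ m → H (polynomialSequence n A m)
    lower∈ m = resp (drop-top-term n A m) (⊖∈ (φ∈ m) (fromℕ•∈ (m ℕ.^ n) (top-coefficient∈ n A φ∈ A≗0)))

module Elimination (K : FiniteField) where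
  open FieldArithmetic K
  open Sums K
  open Vectors K

  dot : ∀ {N} → Vector N → Vector N → F
  dot {N} l v = sumFin N (λ t → l t * v t)

  dot-⊖-• : ∀ {N} (l a b : Vector N) x → dot l (a ⊖ x • b) ≡ dot l a - x * dot l b
  dot-⊖-• {zero}  l a b x = solve 1 (λ x → :0 := :0 :- x :* :0) refl x
  dot-⊖-• {suc N} l a b x = trans (cong (l fzero * (a fzero - x * b fzero) +_) (dot-⊖-• (Vec.tail l) (Vec.tail a) (Vec.tail b) x))
    (solve 6 (λ l a b x s t → l :* (a :- x :* b) :+ (s :- x :* t) := (l :* a :+ s) :- x :* (l :* b :+ t)) refl
      (l fzero) (a fzero) (b fzero) x _ _)

  Annihilated : ∀ {N} {I : Set} → List I → (I → Vector N) → Set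
  Annihilated {N} E w = Σ (Vector N) λ l → (Σ (Fin N) λ t → l t ≢ 0#) × (∀ u → u ∈ E → dot l (w u) ≡ 0#)

  LinesIn : ∀ {N} {I : Set} → (Vector N → Set) → List I → (I → Vector N) → Set
  LinesIn H E w = ∀ u → u ∈ E → ∀ a → H (a • w u)

  private
    first-coordinate-annihilated : ∀ {N} {I : Set} (E : List I) (w : I → Vector (suc N)) →
      (∀ u → u ∈ E → w u fzero ≡ 0#) → Annihilated E w
    first-coordinate-annihilated {N} E w w₀≡0 = 1# Vec.∷ (λ _ → 0#) , (fzero , λ 1≡0 → 0≢1 (sym 1≡0)) , dot≡0
      where
      dot≡0 : ∀ u → u ∈ E → dot (1# Vec.∷ (λ _ → 0#)) (w u) ≡ 0#
      dot≡0 u u∈E = trans (cong₂ _+_ (trans (cong (1# *_) (w₀≡0 u u∈E)) (zeroʳ 1#))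
                                      (sumFin-zero N _ (λ t → zeroˡ (w u (fsuc t)))))
                          (+-identityˡ 0#)

    -- Clearing the first coordinate of every w u against the pivot w u₀.
    module Pivot {N} {I : Set} (E : List I) (w : I → Vector (suc N)) {H : Vector (suc N) → Set}
      (subgroup : IsAdditiveSubgroup H) (lines∈ : LinesIn H E w)
      {u₀ : I} (u₀∈E : u₀ ∈ E) (r≢0 : w u₀ fzero ≢ 0#) where
      open IsAdditiveSubgroup subgroup

      r = w u₀ fzero

      ratio : I → F
      ratio u = w u fzero * inv r

      w′ : I → Vector N
      w′ u = Vec.tail (w u) ⊖ ratio u • Vec.tail (w u₀)

      H′ : Vector N → Set
      H′ v = H (0# Vec.∷ v)

      lines∈′ : LinesIn H′ E w′
      lines∈′ u u∈E a = resp cleared (⊕∈ (lines∈ u u∈E a) (lines∈ u₀ u₀∈E (- (a * ratio u))))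
        where
        cleared : a • w u ⊕ (- (a * ratio u)) • w u₀ ≗ 0# Vec.∷ (a • w′ u)
        cleared fzero = begin
          a * w u fzero + (- (a * (w u fzero * inv r))) * r
            ≡⟨ solve 4 (λ a x i r → a :* x :+ (:- (a :* (x :* i))) :* r := a :* x :* (:1 :- i :* r)) refl a (w u fzero) (inv r) r ⟩
          a * w u fzero * (1# - inv r * r)
            ≡⟨ cong (λ y → a * w u fzero * (1# - y)) (inv-l r r≢0) ⟩
          a * w u fzero * (1# - 1#)
            ≡⟨ solve 2 (λ a x → a :* x :* (:1 :- :1) := :0) refl a (w u fzero) ⟩
          0# ∎
          where open ≡-Reasoning
        cleared (fsuc t) = solve 4 (λ a x k y → a :* x :+ (:- (a :* k)) :* y := a :* (x :- k :* y)) refl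
                                   a (w u (fsuc t)) (ratio u) (w u₀ (fsuc t))

      lift-all : (∀ v → H′ v) → ∀ v → H v
      lift-all all v = resp split (⊕∈ (all (Vec.tail v ⊖ c • Vec.tail (w u₀))) (lines∈ u₀ u₀∈E c))
        where
        c = v fzero * inv r
        split : (0# Vec.∷ (Vec.tail v ⊖ c • Vec.tail (w u₀))) ⊕ c • w u₀ ≗ v
        split fzero    = trans (solve 3 (λ v i r → :0 :+ v :* i :* r := v :* (i :* r)) refl (v fzero) (inv r) r)
                               (trans (cong (v fzero *_) (inv-l r r≢0)) (*-identityʳ _))
        split (fsuc t) = solve 3 (λ x c y → x :- c :* y :+ c :* y := x) refl (v (fsuc t)) c (w u₀ (fsuc t))

      lift-annihilated : Annihilated E w′ → Annihilated E w
      lift-annihilated (l , (t , lt≢0) , dot≡0) = L , (fsuc t , lt≢0) , dot-L≡0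
        where
        D = dot l (Vec.tail (w u₀))
        L : Vector (suc N)
        L = (- D * inv r) Vec.∷ l
        dot-L≡0 : ∀ u → u ∈ E → dot L (w u) ≡ 0#
        dot-L≡0 u u∈E = begin
          (- D * inv r) * w u fzero + dot l (Vec.tail (w u))
            ≡⟨ cong ((- D * inv r) * w u fzero +_) (solve 3 (λ s k d → s := (s :- k :* d) :+ k :* d) refl _ (ratio u) D) ⟩
          (- D * inv r) * w u fzero + ((dot l (Vec.tail (w u)) - ratio u * D) + ratio u * D)
            ≡⟨ cong (λ y → (- D * inv r) * w u fzero + (y + ratio u * D))
                    (trans (sym (dot-⊖-• l (Vec.tail (w u)) (Vec.tail (w u₀)) (ratio u))) (dot≡0 u u∈E)) ⟩
          (- D * inv r) * w u fzero + (0# + ratio u * D)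
            ≡⟨ solve 3 (λ d i x → (:- d :* i) :* x :+ (:0 :+ x :* i :* d) := :0) refl D (inv r) (w u fzero) ⟩
          0# ∎
          where open ≡-Reasoning

  span-or-annihilated : ∀ N {I : Set} (E : List I) (w : I → Vector N) {H : Vector N → Set} →
    IsAdditiveSubgroup H → LinesIn H E w → (∀ v → H v) ⊎ Annihilated E w
  span-or-annihilated zero E w subgroup _ = inj₁ (λ v → resp (λ ()) 0∈)
    where open IsAdditiveSubgroup subgroup
  span-or-annihilated (suc N) E w subgroup lines∈ with any? (λ u → ¬? (w u fzero ≟ 0#)) E
  ... | no none = inj₂ (first-coordinate-annihilated E w λ u u∈E →
                         decidable-stable (w u fzero ≟ 0#) (λ w₀≢0 → none (lose u∈E w₀≢0)))
  ... | yes some with find some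
  ... | u₀ , u₀∈E , r≢0 = Sum.map lift-all lift-annihilated (span-or-annihilated N E w′ (0∷-subgroup subgroup) lines∈′)
    where open Pivot E w subgroup lines∈ u₀∈E r≢0

module PolynomialFunctions (K : FiniteField) where
  open FieldArithmetic K
  open Characteristic K using (2≤card)
  open Sums K

  horner : ∀ L → (Fin L → F) → F → F
  horner zero    P x = 0#
  horner (suc L) P x = P fzero + x * horner L (Vec.tail P) x

  divide : ∀ L → F → (Fin (suc L) → F) → (Fin L → F) × F
  divide zero    r P = (λ ()) , P fzero
  divide (suc L) r P with divide L r (Vec.tail P)
  ... | Q , R = R Vec.∷ Q , P fzero + r * R

  horner-divide : ∀ L r P x → horner (suc L) P x ≡ (x - r) * horner L (proj₁ (divide L r P)) x + proj₂ (divide L r P)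
  horner-divide zero    r P x = solve 3 (λ p x r → p :+ x :* :0 := (x :- r) :* :0 :+ p) refl (P fzero) x r
  horner-divide (suc L) r P x with divide L r (Vec.tail P) | horner-divide L r (Vec.tail P) x
  ... | Q , R | tail≡ = trans (cong (λ y → P fzero + x * y) tail≡)
    (solve 5 (λ p x r q R → p :+ x :* ((x :- r) :* q :+ R) := (x :- r) :* (R :+ x :* q) :+ (p :+ r :* R)) refl
      (P fzero) x r (horner L Q x) R)

  divide≡0⇒≡0 : ∀ L r P → (∀ j → proj₁ (divide L r P) j ≡ 0#) → proj₂ (divide L r P) ≡ 0# → ∀ j → P j ≡ 0#
  divide≡0⇒≡0 zero    r P Q≡0 R≡0 fzero = R≡0
  divide≡0⇒≡0 (suc L) r P Q≡0 R≡0 j with divide L r (Vec.tail P) | divide≡0⇒≡0 L r (Vec.tail P)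
  divide≡0⇒≡0 (suc L) r P Q≡0 R≡0 fzero    | Q , R | _ =
    trans (sym (+-identityʳ _)) (trans (cong (P fzero +_) (sym (trans (cong (r *_) (Q≡0 fzero)) (zeroʳ r)))) R≡0)
  divide≡0⇒≡0 (suc L) r P Q≡0 R≡0 (fsuc j) | Q , R | tail≡0 = tail≡0 (λ j → Q≡0 (fsuc j)) (Q≡0 fzero) j

  roots⇒≡0 : ∀ L (P : Fin L → F) (rs : List F) → Unique rs → length rs ≡ L →
    (∀ r → r ∈ rs → horner L P r ≡ 0#) → ∀ j → P j ≡ 0#
  roots⇒≡0 (suc L) P (r ∷ rs) (r∉rs ∷ rs-unique) length≡ roots = divide≡0⇒≡0 L r P Q≡0 R≡0
    where
    Q = proj₁ (divide L r P)
    R = proj₂ (divide L r P)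
    R≡0 : R ≡ 0#
    R≡0 = begin
      R                             ≡⟨ solve 3 (λ r q R → R := (r :- r) :* q :+ R) refl r (horner L Q r) R ⟩
      (r - r) * horner L Q r + R    ≡⟨ sym (horner-divide L r P r) ⟩
      horner (suc L) P r            ≡⟨ roots r (here refl) ⟩
      0#                            ∎
      where open ≡-Reasoning
    Q-roots : ∀ r′ → r′ ∈ rs → horner L Q r′ ≡ 0#
    Q-roots r′ r′∈rs = x*y≡0⇒y≡0 r′-r≢0 (begin
      (r′ - r) * horner L Q r′           ≡⟨ sym (trans (cong ((r′ - r) * horner L Q r′ +_) R≡0) (+-identityʳ _)) ⟩
      (r′ - r) * horner L Q r′ + R       ≡⟨ sym (horner-divide L r P r′) ⟩
      horner (suc L) P r′                ≡⟨ roots r′ (there r′∈rs) ⟩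
      0#                                 ∎)
      where
      open ≡-Reasoning
      r′-r≢0 : r′ - r ≢ 0#
      r′-r≢0 r′-r≡0 = All.lookup r∉rs r′∈rs (sym (begin
        r′              ≡⟨ solve 2 (λ a b → a := (a :- b) :+ b) refl r′ r ⟩
        (r′ - r) + r    ≡⟨ cong (_+ r) r′-r≡0 ⟩
        0# + r          ≡⟨ +-identityˡ r ⟩
        r               ∎))
    Q≡0 : ∀ j → Q j ≡ 0#
    Q≡0 = roots⇒≡0 L Q rs rs-unique (ℕ.suc-injective length≡) Q-roots

  horner≡sumFin : ∀ L P x → horner L P x ≡ sumFin L (λ j → P j * x ^F toℕ j)
  horner≡sumFin zero    P x = refl
  horner≡sumFin (suc L) P x = begin
    P fzero + x * horner L (Vec.tail P) x
      ≡⟨ cong (λ y → P fzero + x * y) (horner≡sumFin L (Vec.tail P) x) ⟩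
    P fzero + x * sumFin L (λ j → P (fsuc j) * x ^F toℕ j)
      ≡⟨ cong₂ _+_ (sym (*-identityʳ (P fzero))) (sym (sumFin-*ˡ L x _)) ⟩
    P fzero * 1# + sumFin L (λ j → x * (P (fsuc j) * x ^F toℕ j))
      ≡⟨ cong (P fzero * 1# +_) (sumFin-cong L (λ j → solve 3 (λ x a b → x :* (a :* b) := a :* (x :* b)) refl x (P (fsuc j)) (x ^F toℕ j))) ⟩
    P fzero * 1# + sumFin L (λ j → P (fsuc j) * (x * x ^F toℕ j)) ∎
    where open ≡-Reasoning

  eval≡0⇒≡0 : (P : Poly) → (∀ x → eval P x ≡ 0#) → ∀ j → P j ≡ 0#
  eval≡0⇒≡0 P P≡0 = roots⇒≡0 card P elems unique refl (λ x _ → trans (horner≡sumFin card P x) (P≡0 x))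

  eval-+ : ∀ P Q x → eval (λ j → P j + Q j) x ≡ eval P x + eval Q x
  eval-+ P Q x = trans (sumFin-cong card (λ j → distribʳ _ (P j) (Q j))) (sumFin-+ card _ _)

  eval-*ˡ : ∀ a P x → eval (λ j → a * P j) x ≡ a * eval P x
  eval-*ˡ a P x = trans (sumFin-cong card (λ j → *-assoc a (P j) _)) (sumFin-*ˡ card a _)

  eval-sumFin : ∀ m (b : Fin m → F) (P : Fin m → Poly) x →
    eval (λ j → sumFin m (λ i → b i * P i j)) x ≡ sumFin m (λ i → b i * eval (P i) x)
  eval-sumFin m b P x = begin
    sumFin card (λ j → sumFin m (λ i → b i * P i j) * x ^F toℕ j)
      ≡⟨ sumFin-cong card (λ j → sym (sumFin-*ʳ m _ _)) ⟩
    sumFin card (λ j → sumFin m (λ i → b i * P i j * x ^F toℕ j))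
      ≡⟨ sumFin-swap card m (λ i j → b i * P i j * x ^F toℕ j) ⟩
    sumFin m (λ i → sumFin card (λ j → b i * P i j * x ^F toℕ j))
      ≡⟨ sumFin-cong m (λ i → trans (sumFin-cong card (λ j → *-assoc (b i) _ _)) (sumFin-*ˡ card (b i) _)) ⟩
    sumFin m (λ i → b i * eval (P i) x) ∎
    where open ≡-Reasoning

  monoP-≡ : ∀ {k} j → toℕ j ≡ k → monoP k j ≡ 1#
  monoP-≡ {k} j toℕ≡k with toℕ j ℕ.≟ k
  ... | yes _    = refl
  ... | no toℕ≢k = contradiction toℕ≡k toℕ≢k

  monoP-≢ : ∀ {k} j → toℕ j ≢ k → monoP k j ≡ 0#
  monoP-≢ {k} j toℕ≢k with toℕ j ℕ.≟ k
  ... | yes toℕ≡k = contradiction toℕ≡k toℕ≢k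
  ... | no _      = refl

  eval-monoP : ∀ k → k < card → ∀ x → eval (monoP k) x ≡ x ^F k
  eval-monoP k k<card x = begin
    eval (monoP k) x          ≡⟨ sumFin-single card _ j₀ (λ j j≢j₀ → trans (cong (_* _) (monoP-≢ j (j≢j₀ ∘ toℕ≡k⇒≡j₀ j))) (zeroˡ _)) ⟩
    monoP k j₀ * x ^F toℕ j₀  ≡⟨ cong₂ (λ a n → a * x ^F n) (monoP-≡ j₀ toℕ-j₀) toℕ-j₀ ⟩
    1# * x ^F k               ≡⟨ *-identityˡ _ ⟩
    x ^F k                    ∎
    where
    open ≡-Reasoning
    j₀ = Fin.fromℕ< k<card
    toℕ-j₀ : toℕ j₀ ≡ k
    toℕ-j₀ = Fin.toℕ-fromℕ< k<card
    toℕ≡k⇒≡j₀ : ∀ j → toℕ j ≡ k → j ≡ j₀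
    toℕ≡k⇒≡j₀ j toℕ≡k = Fin.toℕ-injective (trans toℕ≡k (sym toℕ-j₀))

  eval-combination : ∀ {m} a₀ a₁ (b : Fin m → F) (P : Fin m → Poly) x →
    eval (λ j → a₀ * monoP 0 j + a₁ * monoP 1 j + sumFin m (λ i → b i * P i j)) x
      ≡ a₀ + a₁ * x + sumFin m (λ i → b i * eval (P i) x)
  eval-combination {m} a₀ a₁ b P x = begin
    eval (λ j → a₀ * monoP 0 j + a₁ * monoP 1 j + sumFin m (λ i → b i * P i j)) x
      ≡⟨ trans (eval-+ _ _ x) (cong₂ _+_ (trans (eval-+ _ _ x) (cong₂ _+_ (eval-*ˡ _ _ x) (eval-*ˡ _ _ x))) (eval-sumFin m b P x)) ⟩
    a₀ * eval (monoP 0) x + a₁ * eval (monoP 1) x + S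
      ≡⟨ cong₂ (λ y z → a₀ * y + a₁ * z + S) (eval-monoP 0 (ℕ.<-trans (s≤s z≤n) 2≤card) x) (eval-monoP 1 2≤card x) ⟩
    a₀ * 1# + a₁ * (x * 1#) + S
      ≡⟨ solve 4 (λ a₀ a₁ x s → a₀ :* :1 :+ a₁ :* (x :* :1) :+ s := a₀ :+ a₁ :* x :+ s) refl a₀ a₁ x S ⟩
    a₀ + a₁ * x + S ∎
    where
    open ≡-Reasoning
    S = sumFin m (λ i → b i * eval (P i) x)

  coeff-toℕ : ∀ P j → coeff P (toℕ j) ≡ P j
  coeff-toℕ P j with toℕ j ℕ.<? card
  ... | yes j<card = cong P (Fin.fromℕ<-toℕ j j<card)
  ... | no  j≮card = contradiction (Fin.toℕ<n j) j≮card

  coeff-DegLe : ∀ P d → DegLe P d → ∀ k → d < k → coeff P k ≡ 0#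
  coeff-DegLe P d deg≤d k d<k with k ℕ.<? card
  ... | yes k<card = deg≤d (Fin.fromℕ< k<card) (subst (d <_) (sym (Fin.toℕ-fromℕ< k<card)) d<k)
  ... | no  _      = refl

  eval≡sumTo : ∀ P x → eval P x ≡ sumTo card (λ k → coeff P k * x ^F k)
  eval≡sumTo P x = trans (sumFin-cong card (λ j → cong (_* x ^F toℕ j) (sym (coeff-toℕ P j))))
                         (sumFin-sumTo card (λ k → coeff P k * x ^F k))

  eval-0 : ∀ P → eval P 0# ≡ coeff P 0
  eval-0 P = begin
    eval P 0#                                  ≡⟨ eval≡sumTo P 0# ⟩
    sumTo card (λ k → coeff P k * 0# ^F k)     ≡⟨ sumTo-truncate card _ (ℕ.<-trans (s≤s z≤n) 2≤card) higher≡0 ⟩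
    coeff P 0 * 1# + 0#                        ≡⟨ solve 1 (λ a → a :* :1 :+ :0 := a) refl (coeff P 0) ⟩
    coeff P 0                                  ∎
    where
    open ≡-Reasoning
    higher≡0 : ∀ k → 1 ≤ k → coeff P k * 0# ^F k ≡ 0#
    higher≡0 (suc k) _ = trans (cong (coeff P (suc k) *_) (zeroˡ _)) (zeroʳ _)

  eval-DegLe-1 : ∀ P → DegLe P 1 → ∀ x → eval P x ≡ coeff P 0 + coeff P 1 * x
  eval-DegLe-1 P deg≤1 x = begin
    eval P x                                         ≡⟨ eval≡sumTo P x ⟩
    sumTo card (λ k → coeff P k * x ^F k)            ≡⟨ sumTo-truncate card _ 2≤card higher≡0 ⟩
    coeff P 1 * (x * 1#) + (coeff P 0 * 1# + 0#)     ≡⟨ solve 3 (λ a b x → b :* (x :* :1) :+ (a :* :1 :+ :0) := a :+ b :* x) refl (coeff P 0) (coeff P 1) x ⟩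
    coeff P 0 + coeff P 1 * x                        ∎
    where
    open ≡-Reasoning
    higher≡0 : ∀ k → 2 ≤ k → coeff P k * x ^F k ≡ 0#
    higher≡0 k 2≤k = trans (cong (_* x ^F k) (coeff-DegLe P 1 deg≤1 k 2≤k)) (zeroˡ _)

  Odd⇒coeff₀≡0 : fromℕ 2 ≢ 0# → ∀ P → Odd P → coeff P 0 ≡ 0#
  Odd⇒coeff₀≡0 2≢0 P odd with 0 ℕ.<? card
  ... | no _      = refl
  ... | yes 0<card = x*y≡0⇒y≡0 2≢0 (begin
    fromℕ 2 * c₀             ≡⟨ solve 1 (λ c → (:1 :+ (:1 :+ :0)) :* c := c :+ c) refl c₀ ⟩
    c₀ + c₀                  ≡⟨ cong (c₀ +_) c₀≡-c₀ ⟩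
    c₀ - c₀                  ≡⟨ -‿inverseʳ c₀ ⟩
    0#                       ∎)
    where
    open ≡-Reasoning
    j₀ = Fin.fromℕ< 0<card
    c₀ = P j₀
    c₀≡-c₀ : c₀ ≡ - c₀
    c₀≡-c₀ = trans (sym (*-identityʳ c₀)) (trans (cong (λ k → c₀ * (- 1#) ^F k) (sym (Fin.toℕ-fromℕ< 0<card))) (odd j₀))

  -- A field with a third element has one outside {0, -1}: else X + X² would vanish everywhere.
  ∃x≢0∧1+x≢0 : 2 < card → Σ F λ ω → ω ≢ 0# × 1# + ω ≢ 0#
  ∃x≢0∧1+x≢0 2<card with any? (λ x → ¬? ((x * (1# + x)) ≟ 0#)) elems
  ... | yes some with find some
  ... | ω , _ , ω[1+ω]≢0 = ω , (λ ω≡0 → ω[1+ω]≢0 (trans (cong (_* (1# + ω)) ω≡0) (zeroˡ _)))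
                            , (λ 1+ω≡0 → ω[1+ω]≢0 (trans (cong (ω *_) 1+ω≡0) (zeroʳ ω)))
  ∃x≢0∧1+x≢0 2<card | no none = contradiction (trans (sym (X+X²≡0 j₁)) X+X²[j₁]≡1) 0≢1
    where
    X+X² : Poly
    X+X² j = monoP 1 j + monoP 2 j
    X+X²≡0 : ∀ j → X+X² j ≡ 0#
    X+X²≡0 = eval≡0⇒≡0 X+X² λ x → begin
      eval X+X² x                      ≡⟨ trans (eval-+ _ _ x) (cong₂ _+_ (eval-monoP 1 2≤card x) (eval-monoP 2 2<card x)) ⟩
      x * 1# + x * (x * 1#)            ≡⟨ solve 1 (λ x → x :* :1 :+ x :* (x :* :1) := x :* (:1 :+ x)) refl x ⟩
      x * (1# + x)                     ≡⟨ decidable-stable ((x * (1# + x)) ≟ 0#) (λ x[1+x]≢0 → none (lose (complete x) x[1+x]≢0)) ⟩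
      0#                               ∎
      where open ≡-Reasoning
    j₁ = Fin.fromℕ< 2≤card
    toℕ-j₁ : toℕ j₁ ≡ 1
    toℕ-j₁ = Fin.toℕ-fromℕ< 2≤card
    X+X²[j₁]≡1 : X+X² j₁ ≡ 1#
    X+X²[j₁]≡1 = trans (cong₂ _+_ (monoP-≡ j₁ toℕ-j₁) (monoP-≢ j₁ (λ toℕ≡2 → contradiction (trans (sym toℕ-j₁) toℕ≡2) λ ())))
                       (+-identityʳ 1#)

  -- Over F₂ every polynomial is a combination of 1 and X.
  card≡2⇒¬LinIndep1Xf : card ≡ 2 → ∀ {m} → 0 < m → (P : Fin m → Poly) → ¬ LinIndep1Xf P
  card≡2⇒¬LinIndep1Xf card≡2 {suc m} _ P independent = 0≢1 (sym (trans (sym (-‿involutive 1#)) (trans (cong -_ b₀≡0) -0#≈0#)))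
    where
    P₀ = P fzero
    b : Fin (suc m) → F
    b fzero    = - 1#
    b (fsuc _) = 0#
    P₀-affine : ∀ x → eval P₀ x ≡ coeff P₀ 0 + coeff P₀ 1 * x
    P₀-affine = eval-DegLe-1 P₀ λ j 1<j → contradiction (subst (toℕ j <_) card≡2 (Fin.toℕ<n j)) (ℕ.≤⇒≯ 1<j)
    relation≡0 : ∀ x → eval (λ j → coeff P₀ 0 * monoP 0 j + coeff P₀ 1 * monoP 1 j + sumFin (suc m) (λ i → b i * P i j)) x ≡ 0#
    relation≡0 x = begin
      _ ≡⟨ eval-combination (coeff P₀ 0) (coeff P₀ 1) b P x ⟩
      coeff P₀ 0 + coeff P₀ 1 * x + (- 1# * eval P₀ x + sumFin m (λ i → 0# * eval (P (fsuc i)) x))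
        ≡⟨ cong₂ (λ y z → coeff P₀ 0 + coeff P₀ 1 * x + (- 1# * y + z)) (P₀-affine x) (sumFin-zero m _ (λ i → zeroˡ _)) ⟩
      coeff P₀ 0 + coeff P₀ 1 * x + (- 1# * (coeff P₀ 0 + coeff P₀ 1 * x) + 0#)
        ≡⟨ solve 3 (λ a₀ a₁ x → a₀ :+ a₁ :* x :+ (:- :1 :* (a₀ :+ a₁ :* x) :+ :0) := :0) refl (coeff P₀ 0) (coeff P₀ 1) x ⟩
      0# ∎
      where open ≡-Reasoning
    b₀≡0 : - 1# ≡ 0#
    b₀≡0 = proj₂ (proj₂ (independent (coeff P₀ 0) (coeff P₀ 1) b (eval≡0⇒≡0 _ relation≡0))) fzero

module Binomial (K : FiniteField) (x : FiniteField.F K) where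
  open FieldArithmetic K
  open Sums K

  -- binomial j k is the coefficient of y^k in (x + y)^j, and binomial-pred j k = binomial j (k - 1), or 0 for k = 0.
  binomial binomial-pred : ℕ → ℕ → F
  binomial zero    zero    = 1#
  binomial zero    (suc k) = 0#
  binomial (suc j) k       = x * binomial j k + binomial-pred j k
  binomial-pred j zero    = 0#
  binomial-pred j (suc k) = binomial j k

  binomial-< : ∀ j k → j < k → binomial j k ≡ 0#
  binomial-< zero    (suc k) _         = refl
  binomial-< (suc j) (suc k) (s≤s j<k) =
    trans (cong₂ (λ a b → x * a + b) (binomial-< j (suc k) (ℕ.m<n⇒m<1+n j<k)) (binomial-< j k j<k))
          (solve 1 (λ x → x :* :0 :+ :0 := :0) refl x)

  binomial-diagonal : ∀ j → binomial j j ≡ 1#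
  binomial-diagonal zero    = refl
  binomial-diagonal (suc j) =
    trans (cong₂ (λ a b → x * a + b) (binomial-< j (suc j) ℕ.≤-refl) (binomial-diagonal j))
          (solve 1 (λ x → x :* :0 :+ :1 := :1) refl x)

  binomial-subdiagonal : ∀ j → binomial (suc j) j ≡ fromℕ (suc j) * x
  binomial-subdiagonal zero    = solve 1 (λ x → x :* :1 :+ :0 := (:1 :+ :0) :* x) refl x
  binomial-subdiagonal (suc j) =
    trans (cong₂ (λ a b → x * a + b) (binomial-diagonal (suc j)) (binomial-subdiagonal j))
          (solve 2 (λ x n → x :* :1 :+ n :* x := (:1 :+ n) :* x) refl x (fromℕ (suc j)))

  binomial-theorem : ∀ j n → j < n → ∀ y → (x + y) ^F j ≡ sumTo n (λ k → y ^F k * binomial j k)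
  binomial-theorem zero (suc n) _ y = sym (trans (sumTo-single (suc n) _ (s≤s z≤n) higher≡0) (*-identityˡ 1#))
    where
    higher≡0 : ∀ k → k ≢ 0 → y ^F k * binomial 0 k ≡ 0#
    higher≡0 zero    0≢0 = contradiction refl 0≢0
    higher≡0 (suc k) _   = zeroʳ _
  binomial-theorem (suc j) (suc n) (s≤s j<n) y = sym (begin
    sumTo (suc n) (λ k → y ^F k * (x * binomial j k + binomial-pred j k))
      ≡⟨ sumTo-cong (suc n) (λ k → distribˡ (y ^F k) _ _) ⟩
    sumTo (suc n) (λ k → y ^F k * (x * binomial j k) + y ^F k * binomial-pred j k)
      ≡⟨ sumTo-+ (suc n) _ _ ⟩
    sumTo (suc n) (λ k → y ^F k * (x * binomial j k)) + sumTo (suc n) (λ k → y ^F k * binomial-pred j k)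
      ≡⟨ cong₂ _+_ (trans (sumTo-cong (suc n) (λ k → solve 3 (λ a x b → a :* (x :* b) := x :* (a :* b)) refl (y ^F k) x (binomial j k)))
                          (sumTo-*ˡ (suc n) x _))
                   (sumTo-suc n (λ k → y ^F k * binomial-pred j k)) ⟩
    x * (y ^F n * binomial j n + S) + (1# * 0# + sumTo n (λ k → y * y ^F k * binomial j k))
      ≡⟨ cong₂ (λ a b → x * (y ^F n * a + S) + (1# * 0# + b)) (binomial-< j n j<n)
               (trans (sumTo-cong n (λ k → *-assoc y _ _)) (sumTo-*ˡ n y _)) ⟩
    x * (y ^F n * 0# + S) + (1# * 0# + y * S)
      ≡⟨ solve 4 (λ x y a S → x :* (a :* :0 :+ S) :+ (:1 :* :0 :+ y :* S) := (x :+ y) :* S) refl x y (y ^F n) S ⟩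
    (x + y) * S
      ≡⟨ cong ((x + y) *_) (sym (binomial-theorem j n j<n y)) ⟩
    (x + y) ^F suc j ∎)
    where
    open ≡-Reasoning
    S = sumTo n (λ k → y ^F k * binomial j k)

module Reachability (K : FiniteField) {n : ℕ} (f g : Fin n → FiniteField.Poly K) where
  open FieldArithmetic K
  open Vectors K

  Edge : Vertex n → Vertex n → Set
  Edge = SymClosure (Adj f g)

  Reachable : Vertex n → Set
  Reachable = Star Edge 0V

  private
    x₀ x₁ : Fin (2 ℕ.+ n)
    x₀ = fzero
    x₁ = fsuc fzero

    xᵢ : Fin n → Fin (2 ℕ.+ n)
    xᵢ i = 2 ↑ʳ i

  Adj-resp : ∀ {a a′ b b′} → a ≗ a′ → b ≗ b′ → Adj f g a b → Adj f g a′ b′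
  Adj-resp a≗a′ b≗b′ (a₀≢b₀ , step) =
    (λ a′₀≡b′₀ → a₀≢b₀ (trans (a≗a′ x₀) (trans a′₀≡b′₀ (sym (b≗b′ x₀))))) ,
    λ i → trans (cong₂ _-_ (sym (b≗b′ (xᵢ i))) (sym (a≗a′ (xᵢ i))))
                (trans (step i) (cong₂ (λ d₀ d₁ → eval (g i) d₀ * eval (f i) (d₁ / d₀))
                                       (cong₂ _-_ (b≗b′ x₀) (a≗a′ x₀)) (cong₂ _-_ (b≗b′ x₁) (a≗a′ x₁))))

  Adj-translate : ∀ w {a b} → Adj f g a b → Adj f g (a ⊕ w) (b ⊕ w)
  Adj-translate w {a} {b} (a₀≢b₀ , step) =
    (λ e → a₀≢b₀ (trans (sym (+w-w (a x₀) (w x₀))) (trans (cong (_- w x₀) e) (+w-w (b x₀) (w x₀))))) ,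
    λ i → trans (cancel (a (xᵢ i)) (b (xᵢ i)) (w (xᵢ i)))
                (trans (step i) (sym (cong₂ (λ d₀ d₁ → eval (g i) d₀ * eval (f i) (d₁ / d₀))
                                            (cancel (a x₀) (b x₀) (w x₀)) (cancel (a x₁) (b x₁) (w x₁)))))
    where
    +w-w : ∀ x w → (x + w) - w ≡ x
    +w-w = solve 2 (λ x w → (x :+ w) :- w := x) refl
    cancel : ∀ x y w → (y + w) - (x + w) ≡ y - x
    cancel = solve 3 (λ x y w → (y :+ w) :- (x :+ w) := y :- x) refl

  Edge-resp : ∀ {a a′ b b′} → a ≗ a′ → b ≗ b′ → Edge a b → Edge a′ b′
  Edge-resp {a} {a′} {b} {b′} a≗a′ b≗b′ (fwd ab) = fwd (Adj-resp {a} {a′} {b} {b′} a≗a′ b≗b′ ab)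
  Edge-resp {a} {a′} {b} {b′} a≗a′ b≗b′ (bwd ba) = bwd (Adj-resp {b} {b′} {a} {a′} b≗b′ a≗a′ ba)

  Edge-translate : ∀ w {a b} → Edge a b → Edge (a ⊕ w) (b ⊕ w)
  Edge-translate w {a} {b} (fwd ab) = fwd (Adj-translate w {a} {b} ab)
  Edge-translate w {a} {b} (bwd ba) = bwd (Adj-translate w {b} {a} ba)

  Walk : Vertex n → Vertex n → Set
  Walk = Star Edge

  walk-reverse : ∀ {a b} → Walk a b → Walk b a
  walk-reverse = Star.reverse (SymClosure.symmetric (Adj f g))

  walk-translate : ∀ w {a b} → Walk a b → Walk (a ⊕ w) (b ⊕ w)
  walk-translate w = Star.gmap (_⊕ w) (Edge-translate w)

  neighbour : Vertex n → Vertex n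
  neighbour a fzero            = a x₀ + 1#
  neighbour a (fsuc fzero)     = a x₁
  neighbour a (fsuc (fsuc i)) = a (xᵢ i) + eval (g i) ((a x₀ + 1#) - a x₀) * eval (f i) ((a x₁ - a x₁) / ((a x₀ + 1#) - a x₀))

  Adj-neighbour : ∀ a → Adj f g a (neighbour a)
  Adj-neighbour a = a₀≢a₀+1 , λ i → solve 2 (λ x y → (x :+ y) :- x := y) refl (a (xᵢ i)) _
    where
    a₀≢a₀+1 : a x₀ ≢ a x₀ + 1#
    a₀≢a₀+1 e = 0≢1 (trans (sym (-‿inverseʳ (a x₀))) (trans (cong (_- a x₀) e) (solve 2 (λ x o → (x :+ o) :- x := o) refl (a x₀) 1#)))

  -- Pointwise equal vertices need not be equal (there is no function extensionality),
  -- but they are joined through a common neighbour.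
  walk-respˡ : ∀ {a a′ b} → a ≗ a′ → Walk a b → Walk a′ b
  walk-respˡ {a} {a′} a≗a′ ε = _◅_ {j = neighbour a′} (fwd (Adj-neighbour a′)) (bwd a~neighbour ◅ ε)
    where
    a~neighbour : Adj f g a (neighbour a′)
    a~neighbour = Adj-resp {a′} {a} {neighbour a′} {neighbour a′} (sym ∘ a≗a′) (λ _ → refl) (Adj-neighbour a′)
  walk-respˡ {a} {a′} a≗a′ (_◅_ {j = c} ac cb) = Edge-resp {a} {a′} {c} {c} a≗a′ (λ _ → refl) ac ◅ cb

  walk-resp : ∀ {a a′ b b′} → a ≗ a′ → b ≗ b′ → Walk a b → Walk a′ b′
  walk-resp a≗a′ b≗b′ ab = walk-reverse (walk-respˡ b≗b′ (walk-reverse (walk-respˡ a≗a′ ab)))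

  reachable-subgroup : IsAdditiveSubgroup Reachable
  reachable-subgroup = record
    { resp = walk-resp (λ _ → refl)
    ; 0∈   = ε
    ; ⊕∈   = λ {u} {v} 0→u 0→v → walk-resp (λ _ → refl) (λ t → +-comm (v t) (u t))
                 (0→u ◅◅ walk-respˡ (λ t → +-identityˡ (u t)) (walk-translate u 0→v))
    ; ⊝∈   = λ {u} 0→u → walk-reverse (walk-resp (λ t → solve 1 (λ x → :0 :+ :- x := :- x) refl (u t)) (λ t → -‿inverseʳ (u t))
                 (walk-translate (⊝ u) 0→u))
    }

  Adj⇒reachable : ∀ {v} → Adj f g 0V v → Reachable v
  Adj⇒reachable 0~v = fwd 0~v ◅ ε

  all-reachable⇒connected : (∀ v → Reachable v) → Connected f g
  all-reachable⇒connected reachable a b =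
    walk-resp (λ t → +-identityˡ (a t)) (λ t → solve 2 (λ b a → (b :- a) :+ a := b) refl (b t) (a t))
              (walk-translate a (reachable (b ⊖ a)))

module EdgeExpansion (K : FiniteField) {n : ℕ} (f g : Fin n → FiniteField.Poly K) where
  open FieldArithmetic K
  open Characteristic K using (2≤card)
  open Sums K
  open Vectors K
  open PolynomialFunctions K
  open FiniteDifferences K (2 ℕ.+ n) using (polynomialSequence)

  edge : F → F → Vertex n
  edge u t = t Vec.∷ t * u Vec.∷ λ i → eval (g i) t * eval (f i) u

  Adj-edge : ∀ u t → t ≢ 0# → Adj f g 0V (edge u t)
  Adj-edge u t t≢0 = (λ 0≡t → t≢0 (sym 0≡t)) , λ i → trans (x-0≡x _)
    (cong₂ (λ a b → eval (g i) a * eval (f i) b) (sym (x-0≡x t)) (sym (trans (cong₂ _/_ (x-0≡x (t * u)) (x-0≡x t)) tu/t≡u)))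
    where
    x-0≡x : ∀ x → x - 0# ≡ x
    x-0≡x x = solve 1 (λ x → x :- :0 := x) refl x
    tu/t≡u : (t * u) / t ≡ u
    tu/t≡u = trans (solve 3 (λ t u i → (t :* u) :* i := u :* (t :* i)) refl t u (inv t))
                   (trans (cong (u *_) (inv-r t t≢0)) (*-identityʳ u))

  -- The coefficient of t^k in edge u t.
  column : F → ℕ → Vertex n
  column u (suc zero) = 1# Vec.∷ u Vec.∷ λ i → coeff (g i) 1 * eval (f i) u
  column u k          = 0# Vec.∷ 0# Vec.∷ λ i → coeff (g i) k * eval (f i) u

  column-≢1 : ∀ u k → k ≢ 1 → column u k ≗ 0# Vec.∷ 0# Vec.∷ λ i → coeff (g i) k * eval (f i) u
  column-≢1 u zero          _   = λ _ → refl
  column-≢1 u (suc zero)    1≢1 = contradiction refl 1≢1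
  column-≢1 u (suc (suc k)) _   = λ _ → refl

  private

    column-upper : ∀ u k i → column u k (fsuc (fsuc i)) ≡ coeff (g i) k * eval (f i) u
    column-upper u zero          i = refl
    column-upper u (suc zero)    i = refl
    column-upper u (suc (suc k)) i = refl

    only-linear-term : ∀ t u c → (∀ k → k ≢ 1 → column u k c ≡ 0#) →
      sumTo card (λ k → t ^F k * column u k c) ≡ (t * 1#) * column u 1 c
    only-linear-term t u c column≡0 =
      sumTo-single card _ {1} 2≤card (λ k k≢1 → trans (cong (t ^F k *_) (column≡0 k k≢1)) (zeroʳ _))

  edge-expansion : ∀ u t → edge u t ≗ λ c → sumTo card (λ k → t ^F k * column u k c)
  edge-expansion u t fzero = sym (trans (only-linear-term t u fzero (λ k k≢1 → column-≢1 u k k≢1 fzero))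
                                         (solve 1 (λ t → (t :* :1) :* :1 := t) refl t))
  edge-expansion u t (fsuc fzero) = sym (trans (only-linear-term t u (fsuc fzero) (λ k k≢1 → column-≢1 u k k≢1 (fsuc fzero)))
                                               (solve 2 (λ t u → (t :* :1) :* u := t :* u) refl t u))
  edge-expansion u t (fsuc (fsuc i)) = begin
    eval (g i) t * eval (f i) u
      ≡⟨ cong (_* eval (f i) u) (eval≡sumTo (g i) t) ⟩
    sumTo card (λ k → coeff (g i) k * t ^F k) * eval (f i) u
      ≡⟨ sym (sumTo-*ʳ card _ _) ⟩
    sumTo card (λ k → coeff (g i) k * t ^F k * eval (f i) u)
      ≡⟨ sumTo-cong card (λ k → trans (solve 3 (λ c x e → c :* x :* e := x :* (c :* e)) refl (coeff (g i) k) (t ^F k) (eval (f i) u))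
                                       (cong (t ^F k *_) (sym (column-upper u k i)))) ⟩
    sumTo card (λ k → t ^F k * column u k (fsuc (fsuc i))) ∎
    where open ≡-Reasoning

  edge-polynomialSequence : ∀ u x m → edge u (fromℕ m * x) ≗ polynomialSequence card (λ k → x ^F k • column u k) m
  edge-polynomialSequence u x m c = trans (edge-expansion u (fromℕ m * x) c) (sumTo-cong card (λ k → begin
    (fromℕ m * x) ^F k * column u k c      ≡⟨ cong (_* column u k c) (^F-distrib-* (fromℕ m) x k) ⟩
    fromℕ m ^F k * x ^F k * column u k c   ≡⟨ *-assoc _ _ _ ⟩
    fromℕ m ^F k * (x ^F k * column u k c) ∎))
    where open ≡-Reasoning

module Connectivity (K : FiniteField) {n : ℕ} (f g : Fin n → FiniteField.Poly K) where
  open FieldArithmetic K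
  open Characteristic K using (2≤card; fromℕ≢0)
  open Sums K
  open Vectors K
  open PolynomialFunctions K
  open Elimination K
  open Reachability K f g
  open EdgeExpansion K f g
  open IsAdditiveSubgroup reachable-subgroup

  -- A linear form annihilating every column u 1 gives a linear relation among 1, X and the f i.
  lines-column₁⇒all : LinIndep1Xf f → (∀ i → coeff (g i) 1 ≢ 0#) → (∀ u x → Reachable (x • column u 1)) → ∀ v → Reachable v
  lines-column₁⇒all independent g₁≢0 lines∈ with span-or-annihilated (2 ℕ.+ n) elems (λ u → column u 1) reachable-subgroup (λ u _ → lines∈ u)
  ... | inj₁ all = all
  ... | inj₂ (l , (t , lt≢0) , dot≡0) = contradiction (l≡0 t) lt≢0
    where
    b : Fin n → F
    b i = l (fsuc (fsuc i)) * coeff (g i) 1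
    relation : Poly
    relation j = l fzero * monoP 0 j + l (fsuc fzero) * monoP 1 j + sumFin n (λ i → b i * f i j)
    relation≡0 : ∀ u → eval relation u ≡ 0#
    relation≡0 u = begin
      eval relation u
        ≡⟨ eval-combination (l fzero) (l (fsuc fzero)) b f u ⟩
      l fzero + l (fsuc fzero) * u + sumFin n (λ i → b i * eval (f i) u)
        ≡⟨ solve 3 (λ a₀ a₁ s → a₀ :+ a₁ :+ s := a₀ :* :1 :+ (a₁ :+ s)) refl (l fzero) (l (fsuc fzero) * u) _ ⟩
      l fzero * 1# + (l (fsuc fzero) * u + sumFin n (λ i → b i * eval (f i) u))
        ≡⟨ cong (λ s → l fzero * 1# + (l (fsuc fzero) * u + s)) (sumFin-cong n (λ i → *-assoc _ _ _)) ⟩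
      dot l (column u 1)
        ≡⟨ dot≡0 u (complete u) ⟩
      0# ∎
      where open ≡-Reasoning
    coefficients≡0 = independent (l fzero) (l (fsuc fzero)) b (eval≡0⇒≡0 relation relation≡0)
    l≡0 : ∀ t → l t ≡ 0#
    l≡0 fzero           = proj₁ coefficients≡0
    l≡0 (fsuc fzero)    = proj₁ (proj₂ coefficients≡0)
    l≡0 (fsuc (fsuc i)) = x*y≡0⇒y≡0 (g₁≢0 i) (trans (*-comm _ _) (proj₂ (proj₂ coefficients≡0) i))

  -- For affine g i the combination e x - (e 1 + e ω - e (1 + ω)) of edges is linear in x.
  affine⇒lines-column₁ : (∀ i → DegLe (g i) 1) → ∀ {ω} → ω ≢ 0# → 1# + ω ≢ 0# → ∀ u x → Reachable (x • column u 1)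
  affine⇒lines-column₁ deg≤1 {ω} ω≢0 1+ω≢0 u x with x ≟ 0#
  ... | yes refl = resp (λ c → sym (zeroˡ _)) 0∈
  ... | no x≢0   = resp combination
                     (⊖∈ (edge∈ x x≢0) (⊖∈ (⊕∈ (edge∈ 1# (λ 1≡0 → 0≢1 (sym 1≡0))) (edge∈ ω ω≢0)) (edge∈ (1# + ω) 1+ω≢0)))
    where
    edge∈ : ∀ t → t ≢ 0# → Reachable (edge u t)
    edge∈ t t≢0 = Adj⇒reachable (Adj-edge u t t≢0)
    combination : edge u x ⊖ ((edge u 1# ⊕ edge u ω) ⊖ edge u (1# + ω)) ≗ x • column u 1
    combination fzero           = solve 2 (λ x w → x :- ((:1 :+ w) :- (:1 :+ w)) := x :* :1) refl x ω
    combination (fsuc fzero)    = solve 3 (λ x w u → x :* u :- ((:1 :* u :+ w :* u) :- (:1 :+ w) :* u) := x :* u) refl x ω u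
    combination (fsuc (fsuc i)) = begin
      eval (g i) x * e - ((eval (g i) 1# * e + eval (g i) ω * e) - eval (g i) (1# + ω) * e)
        ≡⟨ cong₂ (λ a b → a * e - b) (affine x) (cong₂ _-_ (cong₂ (λ a b → a * e + b * e) (affine 1#) (affine ω)) (cong (_* e) (affine (1# + ω)))) ⟩
      (c₀ + c₁ * x) * e - (((c₀ + c₁ * 1#) * e + (c₀ + c₁ * ω) * e) - (c₀ + c₁ * (1# + ω)) * e)
        ≡⟨ solve 5 (λ c₀ c₁ x w e → (c₀ :+ c₁ :* x) :* e :- (((c₀ :+ c₁ :* :1) :* e :+ (c₀ :+ c₁ :* w) :* e) :- (c₀ :+ c₁ :* (:1 :+ w)) :* e)
                                    := x :* (c₁ :* e)) refl c₀ c₁ x ω e ⟩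
      x * (c₁ * e) ∎
      where
      open ≡-Reasoning
      e = eval (f i) u
      c₀ = coeff (g i) 0
      c₁ = coeff (g i) 1
      affine : ∀ t → eval (g i) t ≡ c₀ + c₁ * t
      affine = eval-DegLe-1 (g i) (deg≤1 i)

  upper : Vertex n → Vector n
  upper v i = v (fsuc (fsuc i))

  0∷0∷-subgroup : IsAdditiveSubgroup (λ w → Reachable (0# Vec.∷ 0# Vec.∷ w))
  0∷0∷-subgroup = 0∷-subgroup (0∷-subgroup reachable-subgroup)

  -- v = (v₀, 0, 0) + ((1, v₁, 0) - (1, 0, 0)) + (0, 0, upper v), where (x, x u, 0) = x • column u 1 - (0, 0, …).
  lines-column₁∧upper⇒all : (∀ u x → Reachable (x • column u 1)) → (∀ w → Reachable (0# Vec.∷ 0# Vec.∷ w)) → ∀ v → Reachable v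
  lines-column₁∧upper⇒all lines∈ upper∈ v =
    resp decomposition (⊕∈ (⊕∈ (planar∈ (v fzero) 0#) (⊖∈ (planar∈ 1# (v (fsuc fzero))) (planar∈ 1# 0#))) (upper∈ (upper v)))
    where
    planar : F → F → Vertex n
    planar x u = x • column u 1 ⊖ (0# Vec.∷ 0# Vec.∷ λ i → x * (coeff (g i) 1 * eval (f i) u))
    planar∈ : ∀ x u → Reachable (planar x u)
    planar∈ x u = ⊖∈ (lines∈ u x) (upper∈ _)
    decomposition : planar (v fzero) 0# ⊕ (planar 1# (v (fsuc fzero)) ⊖ planar 1# 0#) ⊕ (0# Vec.∷ 0# Vec.∷ upper v) ≗ v
    decomposition fzero           = solve 1 (λ x → x :* :1 :- :0 :+ ((:1 :* :1 :- :0) :- (:1 :* :1 :- :0)) :+ :0 := x) refl (v fzero)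
    decomposition (fsuc fzero)    = solve 2 (λ x y → x :* :0 :- :0 :+ ((:1 :* y :- :0) :- (:1 :* :0 :- :0)) :+ :0 := y) refl (v fzero) (v (fsuc fzero))
    decomposition (fsuc (fsuc i)) = solve 4 (λ a b c w → (a :- a) :+ ((b :- b) :- (c :- c)) :+ w := w) refl _ _ _ (v (fsuc (fsuc i)))

  -- A linear form annihilating the upper parts of every column u j gives a linear relation among the f i.
  lines-column⇒upper : LinIndep f → ∀ {j} → j ≢ 1 → (∀ i → coeff (g i) j ≢ 0#) →
    (∀ u x → Reachable (x • column u j)) → ∀ w → Reachable (0# Vec.∷ 0# Vec.∷ w)
  lines-column⇒upper independent {j} j≢1 gⱼ≢0 lines∈
    with span-or-annihilated n elems B 0∷0∷-subgroup (λ u _ x → resp (λ c → trans (cong (x *_) (column-≢1 u j j≢1 c)) (upper-only u x c)) (lines∈ u x))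
    where
    B : F → Vector n
    B u i = coeff (g i) j * eval (f i) u
    upper-only : ∀ u x → x • (0# Vec.∷ 0# Vec.∷ B u) ≗ 0# Vec.∷ 0# Vec.∷ x • B u
    upper-only u x fzero           = zeroʳ x
    upper-only u x (fsuc fzero)    = zeroʳ x
    upper-only u x (fsuc (fsuc i)) = refl
  ... | inj₁ all = all
  ... | inj₂ (l , (t , lt≢0) , dot≡0) = contradiction (l≡0 t) lt≢0
    where
    b : Fin n → F
    b i = l i * coeff (g i) j
    relation≡0 : ∀ u → eval (λ k → sumFin n (λ i → b i * f i k)) u ≡ 0#
    relation≡0 u = trans (eval-sumFin n b f u) (trans (sumFin-cong n (λ i → *-assoc (l i) _ _)) (dot≡0 u (complete u)))
    l≡0 : ∀ i → l i ≡ 0#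
    l≡0 i = x*y≡0⇒y≡0 (gⱼ≢0 i) (trans (*-comm _ _) (independent b (eval≡0⇒≡0 _ relation≡0) i))

  Hypothesis : ℕ → Set
  Hypothesis d = (LinIndep1Xf f × (∀ i → coeff (g i) 1 ≢ 0#))
               ⊎ (LinIndep f × Σ ℕ (λ j → 2 ≤ j × j ≤ d × (∀ i → coeff (g i) j ≢ 0#)))

  module _ {p : ℕ} (p-prime : Prime p) (fromℕ-p≡0 : fromℕ p ≡ 0#) (p≤card : p ≤ card)
           {d : ℕ} (deg≤d : ∀ i → DegLe (g i) d) (d<p : d < p) (edges∈ : ∀ u t → Reachable (edge u t)) where
    open CoefficientsInSubgroup K reachable-subgroup p-prime fromℕ-p≡0
    open FiniteDifferences K (2 ℕ.+ n) using (polynomialSequence)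

    private
      2≤p : 2 ≤ p
      2≤p = ℕ.nonTrivial⇒n>1 p {{prime⇒nonTrivial p-prime}}

      column-≥p : ∀ u k → p ≤ k → column u k ≗ 0V
      column-≥p u k p≤k c = trans (column-≢1 u k (λ { refl → ℕ.<⇒≱ 2≤p p≤k }) c) (zero-parts c)
        where
        zero-parts : (0# Vec.∷ 0# Vec.∷ λ i → coeff (g i) k * eval (f i) u) ≗ 0V
        zero-parts fzero           = refl
        zero-parts (fsuc fzero)    = refl
        zero-parts (fsuc (fsuc i)) = trans (cong (_* eval (f i) u) (coeff-DegLe (g i) d (deg≤d i) k (ℕ.<-≤-trans d<p p≤k))) (zeroˡ _)

    -- Taking t = m x in edge u t, the edges form a polynomial sequence in m with coefficients x^k • column u k.
    power-lines-column∈ : ∀ u x k → k < card → Reachable (x ^F k • column u k)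
    power-lines-column∈ u x = polynomialSequence-coefficients∈ card (λ k → x ^F k • column u k)
      (λ m → resp (edge-polynomialSequence u x m) (edges∈ u (fromℕ m * x)))
      (λ k p≤k c → trans (cong (x ^F k *_) (column-≥p u k p≤k c)) (zeroʳ _))

    lines-column₁ : ∀ u x → Reachable (x • column u 1)
    lines-column₁ u x = resp (λ c → cong (_* column u 1 c) (*-identityʳ x)) (power-lines-column∈ u x 1 2≤card)

    -- Expanding (x + m)^j in m, the coefficient of m^(j-1) is j x.
    lines-column : ∀ {j} → 0 < j → j < p → ∀ u a → Reachable (a • column u j)
    lines-column {suc j′} 0<j j<p u a = resp jx≡a (polynomialSequence-coefficients∈ (suc j) A sequence∈ A-≥p j′ (ℕ.m<n⇒m<1+n ℕ.≤-refl))
      where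
      j = suc j′
      open Binomial K (a * inv (fromℕ j))
      A : ℕ → Vertex n
      A k = binomial j k • column u j
      sequence∈ : ∀ m → Reachable (polynomialSequence (suc j) A m)
      sequence∈ m = resp expand (power-lines-column∈ u (a * inv (fromℕ j) + fromℕ m) j (ℕ.<-≤-trans j<p p≤card))
        where
        expand : (a * inv (fromℕ j) + fromℕ m) ^F j • column u j ≗ polynomialSequence (suc j) A m
        expand c = begin
          (a * inv (fromℕ j) + fromℕ m) ^F j * column u j c
            ≡⟨ cong (_* column u j c) (binomial-theorem j (suc j) ℕ.≤-refl (fromℕ m)) ⟩
          sumTo (suc j) (λ k → fromℕ m ^F k * binomial j k) * column u j c
            ≡⟨ sym (sumTo-*ʳ (suc j) _ _) ⟩
          sumTo (suc j) (λ k → fromℕ m ^F k * binomial j k * column u j c)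
            ≡⟨ sumTo-cong (suc j) (λ k → *-assoc _ _ _) ⟩
          polynomialSequence (suc j) A m c ∎
          where open ≡-Reasoning
      A-≥p : ∀ k → p ≤ k → A k ≗ 0V
      A-≥p k p≤k c = trans (cong (_* column u j c) (binomial-< j k (ℕ.<-≤-trans j<p p≤k))) (zeroˡ _)
      jx≡a : A j′ ≗ a • column u j
      jx≡a c = cong (_* column u j c) (begin
        binomial j j′                        ≡⟨ binomial-subdiagonal j′ ⟩
        fromℕ j * (a * inv (fromℕ j))        ≡⟨ solve 3 (λ n a i → n :* (a :* i) := a :* (n :* i)) refl (fromℕ j) a (inv (fromℕ j)) ⟩
        a * (fromℕ j * inv (fromℕ j))        ≡⟨ cong (a *_) (inv-r (fromℕ j) (fromℕ≢0 p-prime fromℕ-p≡0 0<j j<p)) ⟩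
        a * 1#                               ≡⟨ *-identityʳ a ⟩
        a                                    ∎)
        where open ≡-Reasoning

    all-reachable : Hypothesis d → ∀ v → Reachable v
    all-reachable (inj₁ (independent , g₁≢0)) = lines-column₁⇒all independent g₁≢0 lines-column₁
    all-reachable (inj₂ (independent , j , 2≤j , j≤d , gⱼ≢0)) = lines-column₁∧upper⇒all lines-column₁
      (lines-column⇒upper independent (λ { refl → ℕ.<-irrefl refl 2≤j }) gⱼ≢0 (lines-column (ℕ.<-trans (s≤s z≤n) 2≤j) (ℕ.≤-<-trans j≤d d<p)))

  g₀≡0⇒edges∈ : (∀ i → coeff (g i) 0 ≡ 0#) → ∀ u t → Reachable (edge u t)
  g₀≡0⇒edges∈ g₀≡0 u t with t ≟ 0#
  ... | no t≢0   = Adj⇒reachable (Adj-edge u t t≢0)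
  ... | yes refl = resp edge-0≗0 0∈
    where
    edge-0≗0 : 0V ≗ edge u 0#
    edge-0≗0 fzero           = refl
    edge-0≗0 (fsuc fzero)    = sym (zeroˡ u)
    edge-0≗0 (fsuc (fsuc i)) = sym (trans (cong (_* eval (f i) u) (trans (eval-0 (g i)) (g₀≡0 i))) (zeroˡ _))

  all-reachable-of-affine : 2 < card → (∀ i → DegLe (g i) 1) → LinIndep1Xf f → (∀ i → coeff (g i) 1 ≢ 0#) → ∀ v → Reachable v
  all-reachable-of-affine 2<card deg≤1 independent g₁≢0 with ∃x≢0∧1+x≢0 2<card
  ... | ω , ω≢0 , 1+ω≢0 = lines-column₁⇒all independent g₁≢0 (affine⇒lines-column₁ deg≤1 ω≢0 1+ω≢0)

  all-reachable-of-linear : 0 < n → (∀ i → DegLe (g i) 1) → Hypothesis 1 → ∀ v → Reachable v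
  all-reachable-of-linear _   deg≤1 (inj₂ (_ , j , 2≤j , j≤1 , _)) = contradiction (ℕ.≤-trans 2≤j j≤1) (λ { (s≤s ()) })
  all-reachable-of-linear 0<n deg≤1 (inj₁ (independent , g₁≢0)) with card ℕ.≟ 2
  ... | yes card≡2 = contradiction independent (card≡2⇒¬LinIndep1Xf card≡2 0<n f)
  ... | no card≢2  = all-reachable-of-affine (ℕ.≤∧≢⇒< 2≤card (card≢2 ∘ sym)) deg≤1 independent g₁≢0

theorem12 : (K : FiniteField) → let open FiniteField K in
    (p e : ℕ) → Prime p → card ≡ p ^ e →
    (n : ℕ) → 1 ≤ n →
    (f g : Fin n → Poly) →
    (∀ i → Odd (g i)) →
    (d : ℕ) → IsMaxDeg g d → 1 ≤ d → d < p →
    ((LinIndep1Xf f × (∀ i → coeff (g i) 1 ≢ 0#))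
    ⊎ (LinIndep f × Σ ℕ (λ j → 2 ≤ j × j ≤ d × (∀ i → coeff (g i) j ≢ 0#)))) →
    Connected f g
theorem12 K p e p-prime card≡p^e n 0<n f g odd d (deg≤d , _) 1≤d d<p hypothesis =
  all-reachable⇒connected (all-reachable-by-characteristic (p ℕ.≟ 2))
  where
  open FieldArithmetic K
  open Characteristic K
  open PolynomialFunctions K using (Odd⇒coeff₀≡0)
  open Reachability K f g
  open Connectivity K f g

  fromℕ-p≡0′ : fromℕ p ≡ 0#
  fromℕ-p≡0′ = fromℕ-p≡0 {e = e} p-prime card≡p^e

  all-reachable-by-characteristic : Dec (p ≡ 2) → ∀ v → Reachable v
  all-reachable-by-characteristic (yes refl) =
    all-reachable-of-linear 0<n (λ i → subst (DegLe (g i)) d≡1 (deg≤d i)) (subst Hypothesis d≡1 hypothesis)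
    where
    d≡1 : d ≡ 1
    d≡1 = ℕ.≤-antisym (ℕ.≤-pred d<p) 1≤d
  all-reachable-by-characteristic (no p≢2) =
    all-reachable p-prime fromℕ-p≡0′ (p≤card {e = e} p-prime card≡p^e) deg≤d d<p (g₀≡0⇒edges∈ g₀≡0) hypothesis
    where
    2<p : 2 < p
    2<p = ℕ.≤∧≢⇒< (ℕ.nonTrivial⇒n>1 p {{prime⇒nonTrivial p-prime}}) (p≢2 ∘ sym)
    g₀≡0 : ∀ i → coeff (g i) 0 ≡ 0#
    g₀≡0 i = Odd⇒coeff₀≡0 (fromℕ≢0 p-prime fromℕ-p≡0′ (s≤s z≤n) 2<p) (g i) (odd i)
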